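{- For $0\le k\le n$, $2^k S_D(n,k)=\#D_{\subseteq}([n],k)$.
   Context: Let $\langle n\rangle=\{ -n,\dots,-1,0,1,\dots,n\}$ and for a set $T$ of integers let $\overline{T}=\{ -t:t\in T\}$. A signed partition of $\langle n\rangle$ with $2k+1$ blocks is a set $\{T_0,T_1,\dots,T_{2k}\}$ of pairwise disjoint nonempty subsets whose union is $\langle n\rangle$, such that $0\in T_0$, $T_0=\overline{T_0}$, and $T_{2i}=\overline{T_{2i-1}}$ for $i\in[k]$. It is of type D if $\#T_0\ne3$. $S_D(n,k)$ is the number of type D signed partitions of $\langle n\rangle$ with $2k+1$ blocks. For $S\subset\mathbb{Z}\setminus\{0\}$, a standard signed partition (SSP) of $S$ with $k$ blocks is a sequence $(S_1,\dots,S_k)$ of pairwise disjoint nonempty subsets of $S\cup\overline{S}$ such that $\{S_1,\dots,S_k,\overline{S_1},\dots,\overline{S_k}\}$ is a partition of $S\cup\overline{S}$ and $\min|S_1|\le\min|S_2|\le\dots\le\min|S_k|$, where $|S_i|=\{|j|:j\in S_i\}$. A partial standard signed partition (PSSP) of $S$ is an SSP of some subset of $S$. Let $B(S,k)$ and $B_{\subseteq}(S,k)$ be the sets of SSPs, respectively PSSPs, of $S$ with $k$ blocks, and $D_{\subseteq}([n],k)=B_{\subseteq}([n],k)\setminus\bigcup_{i=1}^nB([n]\setminus\{i\},k)$. -}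

module Defs where

open import Data.Bool using (Bool; true; false; _∧_; _∨_; not; if_then_else_; _xor_)
open import Data.Nat using (ℕ; zero; suc; _≤ᵇ_; _≡ᵇ_)
open import Data.Integer using (ℤ; +_; -[1+_]; ∣_∣)
open import Data.Fin using (Fin)
open import Data.List using (List; []; _∷_; _++_; map; concatMap; upTo; allFin; length; zip)
open import Data.Vec using (Vec; []; _∷_; toList; replicate; _[_]≔_)
open import Data.Product using (_×_; _,_)
open import Data.Bool.ListAction using (all; any)

count : {A : Set} → (A → Bool) → List A → ℕ
count p [] = 0
count p (x ∷ xs) = if p x then suc (count p xs) else count p xs

_⇔ᵇ_ : Bool → Bool → Bool
a ⇔ᵇ b = not (a xor b)

allBoolVecs : (n : ℕ) → List (Vec Bool n)
allBoolVecs zero = [] ∷ []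
allBoolVecs (suc n) = concatMap (λ v → (true ∷ v) ∷ (false ∷ v) ∷ []) (allBoolVecs n)

allVecsOf : {A : Set} → List A → (k : ℕ) → List (Vec A k)
allVecsOf xs zero = [] ∷ []
allVecsOf xs (suc k) = concatMap (λ v → map (λ x → x ∷ v) xs) (allVecsOf xs k)

cartesian : {A B : Set} → List A → List B → List (A × B)
cartesian xs ys = concatMap (λ x → map (λ y → x , y) ys) xs

pairwiseDisjoint : {A : Set} → List ℤ → (A → ℤ → Bool) → List A → Bool
pairwiseDisjoint U mem [] = true
pairwiseDisjoint U mem (X ∷ Xs) =
  all (λ Y → all (λ x → not (mem X x ∧ mem Y x)) U) Xs ∧ pairwiseDisjoint U mem Xs

sortedᵇ : List ℕ → Bool
sortedᵇ [] = true
sortedᵇ (a ∷ []) = true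
sortedᵇ (a ∷ b ∷ l) = (a ≤ᵇ b) ∧ sortedᵇ (b ∷ l)

-- membership of j ∈ ℕ (1-based) in a subset of [n] given as a Boolean vector
memV : {n : ℕ} → Vec Bool n → ℕ → Bool
memV [] j = false
memV (b ∷ v) zero = false
memV (b ∷ v) (suc zero) = b
memV (b ∷ v) (suc (suc j)) = memV v (suc j)

pmElts : ℕ → List ℤ
pmElts n = concatMap (λ j → + suc j ∷ -[1+ j ] ∷ []) (upTo n)

ballElts : ℕ → List ℤ
ballElts n = + 0 ∷ pmElts n

-- A subset of [n] ∪ -[n]: (positive part, negative part);
-- (p , q) contains  j  iff p has j, and contains -j iff q has j  (1 ≤ j ≤ n).
PMSet : ℕ → Set
PMSet n = Vec Bool n × Vec Bool n

memPM : {n : ℕ} → PMSet n → ℤ → Bool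
memPM (p , q) (+ j) = memV p j
memPM (p , q) -[1+ j ] = memV q (suc j)

conjPM : {n : ℕ} → PMSet n → PMSet n
conjPM (p , q) = (q , p)

allPM : (n : ℕ) → List (PMSet n)
allPM n = cartesian (allBoolVecs n) (allBoolVecs n)

-- A subset of ⟨n⟩: (contains 0?, part in [n] ∪ -[n])
ZSet : ℕ → Set
ZSet n = Bool × PMSet n

memZ : {n : ℕ} → ZSet n → ℤ → Bool
memZ (b , t) (+ zero) = b
memZ (b , t) (+ suc j) = memPM t (+ suc j)
memZ (b , t) -[1+ j ] = memPM t -[1+ j ]

conjZ : {n : ℕ} → ZSet n → ZSet n
conjZ (b , t) = (b , conjPM t)

allZ : (n : ℕ) → List (ZSet n)
allZ n = cartesian (true ∷ false ∷ []) (allPM n)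

eqZ : {n : ℕ} → ZSet n → ZSet n → Bool
eqZ {n} A B = all (λ x → memZ A x ⇔ᵇ memZ B x) (ballElts n)

nonemptyZ : {n : ℕ} → ZSet n → Bool
nonemptyZ {n} A = any (memZ A) (ballElts n)

cardZ : {n : ℕ} → ZSet n → ℕ
cardZ {n} A = count (memZ A) (ballElts n)

-- A set of subsets of ⟨n⟩ (a family), as a characteristic vector indexed by
-- the enumeration  allZ n  of all subsets of ⟨n⟩.
Family : ℕ → Set
Family n = Vec Bool (length (allZ n))

memFam : {n : ℕ} → Family n → ZSet n → Bool
memFam {n} F T = any (λ { (S , b) → b ∧ eqZ S T }) (zip (allZ n) (toList F))

-- a labelling (T₀ , ((T₁ , T₂) , … , (T₂ₖ₋₁ , T₂ₖ)))
Labelling : ℕ → ℕ → Set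
Labelling n k = ZSet n × Vec (ZSet n × ZSet n) k

labBlocks : {n k : ℕ} → Labelling n k → List (ZSet n)
labBlocks (t0 , ps) = t0 ∷ concatMap (λ { (a , b) → a ∷ b ∷ [] }) (toList ps)

isTypeDSignedPartitionVia : (n k : ℕ) → Family n → Labelling n k → Bool
isTypeDSignedPartitionVia n k F (t0 , ps) =
  let Ts = labBlocks {n} {k} (t0 , ps) in
     all nonemptyZ Ts
   ∧ pairwiseDisjoint (ballElts n) memZ Ts
   ∧ all (λ x → any (λ T → memZ T x) Ts) (ballElts n)
   ∧ all (λ T → memFam F T ⇔ᵇ any (eqZ T) Ts) (allZ n)
   ∧ memZ t0 (+ 0)
   ∧ eqZ t0 (conjZ t0)
   ∧ all (λ { (a , b) → eqZ b (conjZ a) }) (toList ps)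
   ∧ not (cardZ t0 ≡ᵇ 3)

isTypeDSignedPartition : (n k : ℕ) → Family n → Bool
isTypeDSignedPartition n k F =
  any (isTypeDSignedPartitionVia n k F)
      (cartesian (allZ n) (allVecsOf (cartesian (allZ n) (allZ n)) k))

S-D : ℕ → ℕ → ℕ
S-D n k = count (isTypeDSignedPartition n k) (allBoolVecs (length (allZ n)))

minAbs : {n : ℕ} → PMSet n → ℕ
minAbs {n} A =
  Data.List.foldr (λ j r → if memPM A (+ suc j) ∨ memPM A -[1+ j ] then suc j else r) 0 (upTo n)

isSSP : (n k : ℕ) → Vec Bool n → Vec (PMSet n) k → Bool
isSSP n k S ss =
  let Ss  = toList ss
      inS = λ (x : ℤ) → memV S ∣ x ∣
      Bs  = Ss ++ map conjPM Ss
      U   = pmElts n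
  in  all (λ A → any (memPM A) U) Ss
    ∧ all (λ A → all (λ x → not (memPM A x) ∨ inS x) U) Ss
    ∧ pairwiseDisjoint U memPM Bs
    ∧ all (λ x → not (inS x) ∨ any (λ A → memPM A x) Bs) U
    ∧ sortedᵇ (map minAbs Ss)

isPSSP : (n k : ℕ) → Vec (PMSet n) k → Bool
isPSSP n k ss = any (λ S → isSSP n k S ss) (allBoolVecs n)

isDsub : (n k : ℕ) → Vec (PMSet n) k → Bool
isDsub n k ss =
  isPSSP n k ss ∧ not (any (λ (i : Fin n) → isSSP n k (replicate n true [ i ]≔ false) ss) (allFin n))

#Dsub : ℕ → ℕ → ℕ
#Dsub n k = count (isDsub n k) (allVecsOf (allPM n) k)

-- A partial standard signed partition (S₁,…,S_k) of S ⊆ [n] determines the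
-- signed partition of ⟨n⟩ with zero block T₀ = {0} ∪ ±([n] ∖ S) and pairs
-- {Sᵢ, S̄ᵢ}, together with k signs recording whether +min|Sᵢ| ∈ Sᵢ.  Conversely,
-- a signed partition and k signs give back the Sᵢ: orient each pair {A, Ā} by
-- its sign and list the pairs by increasing min|A|.  This map Φ is therefore a
-- bijection from PSSPs with k blocks onto signed partitions with k signs, and
-- since #T₀ = 3 means T₀ = {0, ±i}, i.e. S = [n] ∖ {i}, it restricts to a
-- bijection from D_⊆([n],k) onto type D partitions with k signs.

module Submission where

open import Algebra.Properties.CommutativeSemigroup using (interchange)
open import Data.Bool using (Bool; true; false; _∧_; _∨_; not; if_then_else_; T)
open import Data.Bool.Properties using (∧-identityʳ; ∧-zeroʳ; ∨-comm; not-involutive; not-injective)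
open import Data.Bool.ListAction using (all; any)
open import Data.Empty using (⊥; ⊥-elim)
open import Data.Fin using (Fin; toℕ; fromℕ<)
import Data.Fin as Fin
open import Data.Fin.Properties using (toℕ-fromℕ<; toℕ<n)
open import Data.Integer using (ℤ; +_; -[1+_]; ∣_∣; -_)
open import Data.Integer.Properties using (neg-involutive)
open import Data.List using (List; []; _∷_; _++_; map; concatMap; length; upTo; allFin; foldr; zip)
open import Data.List.Properties using (map-cong-local; length-map; map-upTo; ∷-injectiveˡ; ∷-injectiveʳ)
open import Data.List.Membership.Propositional using (_∈_; find; lose)
open import Data.List.Membership.Propositional.Properties
  using (∈-map⁺; ∈-map⁻; ∈-upTo⁺; ∈-upTo⁻; ∈-allFin; ∈-++⁺ˡ; ∈-++⁺ʳ; ∈-++⁻; ∈-concatMap⁺; ∈-concatMap⁻)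
open import Data.List.Relation.Unary.Any using (here; there)
open import Data.List.Relation.Unary.All using ([]; _∷_)
import Data.List.Relation.Unary.All as All
open import Data.List.Relation.Unary.AllPairs using (AllPairs; []; _∷_)
import Data.List.Relation.Unary.AllPairs as AllPairs
import Data.List.Relation.Unary.AllPairs.Properties as AllPairs
open import Data.List.Relation.Unary.Linked using (Linked; []; [-]; _∷_)
open import Data.List.Relation.Binary.Permutation.Propositional using (_↭_; ↭-sym; prep; swap) renaming (refl to ↭-refl; trans to ↭-trans)
open import Data.List.Relation.Binary.Permutation.Propositional.Properties using (∈-resp-↭; All-resp-↭; ++⁺; map⁺; shift; ↭-length)
open import Data.Nat using (ℕ; zero; suc; _+_; _*_; _^_; _≤_; _<_; _≤ᵇ_; _≡ᵇ_; z≤n; s≤s)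
open import Data.Nat.ListAction using (sum)
open import Data.Nat.Properties
  using (+-commutativeSemigroup; *-comm; *-distribˡ-+; suc-injective; +-suc; 0≢1+n; n<1⇒n≡0; n≤1+n;
         ≤-reflexive; ≤-trans; <-irrefl; <-asym; ≤∧≢⇒<; ≤⇒≤ᵇ; ≤ᵇ⇒≤; ≤-decTotalOrder)
open import Data.Product using (Σ; _×_; _,_; proj₁; proj₂)
open import Data.Sum using (_⊎_; inj₁; inj₂)
open import Data.Vec using (Vec; []; _∷_; toList; replicate; _[_]≔_)
open import Data.Vec.Properties using (toList-map; toList-cast; toList∘fromList; length-toList)
import Data.Vec as Vec
open import Function using (_∘_)
open import Relation.Nullary using (¬_)
import Relation.Binary.Construct.On as On
import Data.List.Sort
open import Relation.Binary.PropositionalEquality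
open ≡-Reasoning

open import Defs

-- Boolean reflection and counting

∧-elimˡ : ∀ {a b} → a ∧ b ≡ true → a ≡ true
∧-elimˡ {true} _ = refl

∧-elimʳ : ∀ {a b} → a ∧ b ≡ true → b ≡ true
∧-elimʳ {true} e = e

∧-split : ∀ {a b} → a ∧ b ≡ true → a ≡ true × b ≡ true
∧-split {true} e = refl , e

⇒ᵇ-elim : ∀ {a b} → not a ∨ b ≡ true → a ≡ true → b ≡ true
⇒ᵇ-elim e refl = e

⇒ᵇ-intro : ∀ a {b} → (a ≡ true → b ≡ true) → not a ∨ b ≡ true
⇒ᵇ-intro true f = f refl
⇒ᵇ-intro false _ = refl

∧-intro : ∀ {a b} → a ≡ true → b ≡ true → a ∧ b ≡ true
∧-intro refl refl = refl

∨-introˡ : ∀ {a b} → a ≡ true → a ∨ b ≡ true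
∨-introˡ refl = refl

∨-introʳ : ∀ {a b} → b ≡ true → a ∨ b ≡ true
∨-introʳ {true} _ = refl
∨-introʳ {false} e = e

∨-elim : ∀ {a b} → a ∨ b ≡ true → a ≡ true ⊎ b ≡ true
∨-elim {true} _ = inj₁ refl
∨-elim {false} e = inj₂ e

not≡true⇒false : ∀ {a} → not a ≡ true → a ≡ false
not≡true⇒false {false} _ = refl

false⇒not≡true : ∀ {a} → a ≡ false → not a ≡ true
false⇒not≡true refl = refl

true≢false : ∀ {a} → a ≡ true → a ≡ false → ⊥
true≢false refl ()

¬true⇒false : ∀ {a} → ¬ (a ≡ true) → a ≡ false
¬true⇒false {true} h = ⊥-elim (h refl)
¬true⇒false {false} _ = refl

⇔ᵇ-sound : ∀ {a b} → (a ⇔ᵇ b) ≡ true → a ≡ b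
⇔ᵇ-sound {true} {true} _ = refl
⇔ᵇ-sound {false} {false} _ = refl

⇔ᵇ-refl : ∀ a → (a ⇔ᵇ a) ≡ true
⇔ᵇ-refl true = refl
⇔ᵇ-refl false = refl

module _ {A : Set} (p : A → Bool) where

  all-elim : ∀ {xs x} → all p xs ≡ true → x ∈ xs → p x ≡ true
  all-elim {y ∷ _} e (here refl) = ∧-elimˡ e
  all-elim {y ∷ _} e (there x∈xs) = all-elim (∧-elimʳ {p y} e) x∈xs

  all-intro : ∀ xs → (∀ {x} → x ∈ xs → p x ≡ true) → all p xs ≡ true
  all-intro [] _ = refl
  all-intro (x ∷ xs) h = ∧-intro (h (here refl)) (all-intro xs (h ∘ there))

  any-elim : ∀ xs → any p xs ≡ true → Σ A λ x → x ∈ xs × p x ≡ true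
  any-elim (x ∷ xs) e with ∨-elim {p x} e
  ... | inj₁ px = x , here refl , px
  ... | inj₂ rest with any-elim xs rest
  ... | y , y∈xs , py = y , there y∈xs , py

  any-intro : ∀ {xs x} → x ∈ xs → p x ≡ true → any p xs ≡ true
  any-intro (here refl) px = ∨-introˡ px
  any-intro {y ∷ _} (there x∈xs) px = ∨-introʳ {p y} (any-intro x∈xs px)

  any-false : ∀ xs → (∀ {x} → x ∈ xs → p x ≡ false) → any p xs ≡ false
  any-false xs h = ¬true⇒false λ e → let (_ , x∈xs , px) = any-elim xs e in true≢false px (h x∈xs)

  any-resp-↭ : ∀ {xs ys} → xs ↭ ys → any p xs ≡ any p ys
  any-resp-↭ {xs} {ys} xs↭ys with any p xs in e₁ | any p ys in e₂
  ... | true | true = refl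
  ... | false | false = refl
  ... | true | false = let (_ , x∈ , px) = any-elim xs e₁ in
                       ⊥-elim (true≢false (any-intro (∈-resp-↭ xs↭ys x∈) px) e₂)
  ... | false | true = let (_ , y∈ , py) = any-elim ys e₂ in
                       ⊥-elim (true≢false (any-intro (∈-resp-↭ (↭-sym xs↭ys) y∈) py) e₁)

[_]ᵇ : Bool → ℕ
[ b ]ᵇ = if b then 1 else 0

module _ {A : Set} where

  count-cong : (p q : A → Bool) → ∀ xs → (∀ {x} → x ∈ xs → p x ≡ q x) → count p xs ≡ count q xs
  count-cong p q [] _ = refl
  count-cong p q (x ∷ xs) h with p x | q x | h (here refl) | count-cong p q xs (h ∘ there)
  ... | true | true | _ | r = cong suc r
  ... | false | false | _ | r = r

  count-false : (p : A → Bool) → ∀ xs → (∀ {x} → x ∈ xs → p x ≡ false) → count p xs ≡ 0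
  count-false p [] _ = refl
  count-false p (x ∷ xs) h rewrite h (here refl) = count-false p xs (h ∘ there)

  count-++ : (p : A → Bool) → ∀ xs ys → count p (xs ++ ys) ≡ count p xs + count p ys
  count-++ p [] ys = refl
  count-++ p (x ∷ xs) ys with p x
  ... | true = cong suc (count-++ p xs ys)
  ... | false = count-++ p xs ys

  count≡sum : (p : A → Bool) → ∀ xs → count p xs ≡ sum (map (λ x → [ p x ]ᵇ) xs)
  count≡sum p [] = refl
  count≡sum p (x ∷ xs) with p x
  ... | true = cong suc (count≡sum p xs)
  ... | false = count≡sum p xs

  sum-map-cong : (f g : A → ℕ) → ∀ xs → (∀ {x} → x ∈ xs → f x ≡ g x) → sum (map f xs) ≡ sum (map g xs)
  sum-map-cong f g xs h = cong sum (map-cong-local (All.tabulate h))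

  sum-map-+ : (f g : A → ℕ) → ∀ xs → sum (map (λ x → f x + g x) xs) ≡ sum (map f xs) + sum (map g xs)
  sum-map-+ f g [] = refl
  sum-map-+ f g (x ∷ xs) =
    trans (cong (_+_ (f x + g x)) (sum-map-+ f g xs)) (interchange +-commutativeSemigroup (f x) (g x) _ _)

  count≡0⇒¬witness : (p : A → Bool) → ∀ xs → count p xs ≡ 0 → ∀ {x} → x ∈ xs → p x ≡ true → ⊥
  count≡0⇒¬witness p (y ∷ xs) c (here refl) py rewrite py = 0≢1+n (sym c)
  count≡0⇒¬witness p (y ∷ xs) c (there x∈xs) px with p y
  ... | true = 0≢1+n (sym c)
  ... | false = count≡0⇒¬witness p xs c x∈xs px

  count≡1⇒unique : (p : A → Bool) → ∀ xs → count p xs ≡ 1 →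
    Σ A λ x → x ∈ xs × p x ≡ true × (∀ {y} → y ∈ xs → p y ≡ true → y ≡ x)
  count≡1⇒unique p (x ∷ xs) c with p x in px
  ... | true = x , here refl , px , λ where
                 (here refl) _ → refl
                 (there y∈xs) py → ⊥-elim (count≡0⇒¬witness p xs (suc-injective c) y∈xs py)
  ... | false with count≡1⇒unique p xs c
  ... | y , y∈xs , py , unique = y , there y∈xs , py , λ where
                 (here refl) pz → ⊥-elim (true≢false pz px)
                 (there z∈xs) pz → unique z∈xs pz

module _ {A B : Set} where

  count-concatMap : (p : B → Bool) (f : A → List B) → ∀ xs →
    count p (concatMap f xs) ≡ sum (map (λ x → count p (f x)) xs)
  count-concatMap p f [] = refl
  count-concatMap p f (x ∷ xs) =
    trans (count-++ p (f x) (concatMap f xs)) (cong (_+_ (count p (f x))) (count-concatMap p f xs))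

  count-map : (p : B → Bool) (f : A → B) → ∀ xs → count p (map f xs) ≡ count (p ∘ f) xs
  count-map p f [] = refl
  count-map p f (x ∷ xs) with p (f x)
  ... | true = cong suc (count-map p f xs)
  ... | false = count-map p f xs

  sum-count-swap : (R : A → B → Bool) → ∀ xs ys →
    sum (map (λ x → count (R x) ys) xs) ≡ sum (map (λ y → count (λ x → R x y) xs) ys)
  sum-count-swap R [] ys = sym (sum-zero ys)
    where
    sum-zero : ∀ (zs : List B) → sum (map (λ _ → 0) zs) ≡ 0
    sum-zero [] = refl
    sum-zero (_ ∷ zs) = sum-zero zs
  sum-count-swap R (x ∷ xs) ys = begin
    count (R x) ys + sum (map (λ x → count (R x) ys) xs)
      ≡⟨ cong₂ _+_ (count≡sum (R x) ys) (sum-count-swap R xs ys) ⟩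
    sum (map (λ y → [ R x y ]ᵇ) ys) + sum (map (λ y → count (λ x → R x y) xs) ys)
      ≡⟨ sum-map-+ (λ y → [ R x y ]ᵇ) (λ y → count (λ x → R x y) xs) ys ⟨
    sum (map (λ y → [ R x y ]ᵇ + count (λ x → R x y) xs) ys)
      ≡⟨ sum-map-cong _ _ ys (λ {y} _ → count-cons y) ⟩
    sum (map (λ y → count (λ x → R x y) (x ∷ xs)) ys) ∎
    where
    count-cons : ∀ y → [ R x y ]ᵇ + count (λ x → R x y) xs ≡ count (λ x → R x y) (x ∷ xs)
    count-cons y with R x y
    ... | true = refl
    ... | false = refl

-- Enumerations: lists containing every element exactly once

record BoolEq (A : Set) : Set where
  field
    _==_ : A → A → Bool
    ==-sound : ∀ a b → a == b ≡ true → a ≡ b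
    ==-refl : ∀ a → a == a ≡ true
open BoolEq public

Enumerates : ∀ {A : Set} → BoolEq A → List A → Set
Enumerates E xs = ∀ a → count (_==_ E a) xs ≡ 1

module _ {A : Set} (E : BoolEq A) where

  enumerates-∈ : ∀ {xs} → Enumerates E xs → ∀ a → a ∈ xs
  enumerates-∈ {xs} once a with count≡1⇒unique (_==_ E a) xs (once a)
  ... | x , x∈xs , a==x , _ = subst (_∈ xs) (sym (==-sound E a x a==x)) x∈xs

  ==-agree : (E′ : BoolEq A) → ∀ a b → _==_ E a b ≡ _==_ E′ a b
  ==-agree E′ a b with _==_ E a b in e | _==_ E′ a b in e′
  ... | true | true = refl
  ... | false | false = refl
  ... | true | false = ⊥-elim (true≢false (subst (λ c → _==_ E′ a c ≡ true) (==-sound E a b e) (==-refl E′ a)) e′)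
  ... | false | true = ⊥-elim (true≢false (subst (λ c → _==_ E a c ≡ true) (==-sound E′ a b e′) (==-refl E a)) e)

  enumerates-resp-BoolEq : (E′ : BoolEq A) → ∀ {xs} → Enumerates E xs → Enumerates E′ xs
  enumerates-resp-BoolEq E′ {xs} once a =
    trans (count-cong _ _ xs (λ {x} _ → sym (==-agree E′ a x))) (once a)

boolEq : BoolEq Bool
boolEq = record { _==_ = _⇔ᵇ_ ; ==-sound = λ _ _ → ⇔ᵇ-sound ; ==-refl = ⇔ᵇ-refl }

×-boolEq : ∀ {A B : Set} → BoolEq A → BoolEq B → BoolEq (A × B)
×-boolEq EA EB = record
  { _==_ = λ (a , b) (a′ , b′) → _==_ EA a a′ ∧ _==_ EB b b′
  ; ==-sound = λ (a , b) (a′ , b′) e →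
      cong₂ _,_ (==-sound EA a a′ (∧-elimˡ e)) (==-sound EB b b′ (∧-elimʳ {_==_ EA a a′} e))
  ; ==-refl = λ (a , b) → ∧-intro (==-refl EA a) (==-refl EB b) }

module _ {A : Set} (E : BoolEq A) where

  vec-== : ∀ {k} → Vec A k → Vec A k → Bool
  vec-== [] [] = true
  vec-== (a ∷ as) (b ∷ bs) = _==_ E a b ∧ vec-== as bs

  vec-==-sound : ∀ {k} (as bs : Vec A k) → vec-== as bs ≡ true → as ≡ bs
  vec-==-sound [] [] _ = refl
  vec-==-sound (a ∷ as) (b ∷ bs) e =
    cong₂ _∷_ (==-sound E a b (∧-elimˡ e)) (vec-==-sound as bs (∧-elimʳ {_==_ E a b} e))

  vec-==-refl : ∀ {k} (as : Vec A k) → vec-== as as ≡ true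
  vec-==-refl [] = refl
  vec-==-refl (a ∷ as) = ∧-intro (==-refl E a) (vec-==-refl as)

  vec-boolEq : (k : ℕ) → BoolEq (Vec A k)
  vec-boolEq k = record { _==_ = vec-== ; ==-sound = vec-==-sound ; ==-refl = vec-==-refl }

enumerates-bool : Enumerates boolEq (true ∷ false ∷ [])
enumerates-bool true = refl
enumerates-bool false = refl

enumerates-cartesian : ∀ {A B : Set} (EA : BoolEq A) (EB : BoolEq B) xs ys →
  Enumerates EA xs → Enumerates EB ys → Enumerates (×-boolEq EA EB) (cartesian xs ys)
enumerates-cartesian EA EB xs ys onceA onceB (a , b) = begin
  count (_==_ (×-boolEq EA EB) (a , b)) (cartesian xs ys)
    ≡⟨ count-concatMap _ (λ x → map (x ,_) ys) xs ⟩
  sum (map (λ x → count (_==_ (×-boolEq EA EB) (a , b)) (map (x ,_) ys)) xs)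
    ≡⟨ sum-map-cong _ _ xs (λ {x} _ → row x) ⟩
  sum (map (λ x → [ _==_ EA a x ]ᵇ) xs)
    ≡⟨ count≡sum (_==_ EA a) xs ⟨
  count (_==_ EA a) xs
    ≡⟨ onceA a ⟩
  1 ∎
  where
  row : ∀ x → count (_==_ (×-boolEq EA EB) (a , b)) (map (x ,_) ys) ≡ [ _==_ EA a x ]ᵇ
  row x rewrite count-map (_==_ (×-boolEq EA EB) (a , b)) (x ,_) ys with _==_ EA a x
  ... | true = onceB b
  ... | false = count-false _ ys (λ _ → refl)

enumerates-allVecsOf : ∀ {A : Set} (E : BoolEq A) xs → Enumerates E xs →
  ∀ k → Enumerates (vec-boolEq E k) (allVecsOf xs k)
enumerates-allVecsOf E xs once zero [] = refl
enumerates-allVecsOf E xs once (suc k) (a ∷ as) = begin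
  count (_==_ Eₖ₊₁ (a ∷ as)) (allVecsOf xs (suc k))
    ≡⟨ count-concatMap _ (λ v → map (_∷ v) xs) (allVecsOf xs k) ⟩
  sum (map (λ v → count (_==_ Eₖ₊₁ (a ∷ as)) (map (_∷ v) xs)) (allVecsOf xs k))
    ≡⟨ sum-map-cong _ _ (allVecsOf xs k) (λ {v} _ → column v) ⟩
  sum (map (λ v → [ _==_ Eₖ as v ]ᵇ) (allVecsOf xs k))
    ≡⟨ count≡sum (_==_ Eₖ as) (allVecsOf xs k) ⟨
  count (_==_ Eₖ as) (allVecsOf xs k)
    ≡⟨ enumerates-allVecsOf E xs once k as ⟩
  1 ∎
  where
  Eₖ = vec-boolEq E k
  Eₖ₊₁ = vec-boolEq E (suc k)
  column : ∀ v → count (_==_ Eₖ₊₁ (a ∷ as)) (map (_∷ v) xs) ≡ [ _==_ Eₖ as v ]ᵇ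
  column v rewrite count-map (_==_ Eₖ₊₁ (a ∷ as)) (_∷ v) xs with _==_ Eₖ as v
  ... | true = trans (count-cong _ _ xs (λ {x} _ → ∧-identityʳ (_==_ E a x))) (once a)
  ... | false = count-false _ xs (λ {x} _ → ∧-zeroʳ (_==_ E a x))

allBoolVecs≡allVecsOf : ∀ n → allBoolVecs n ≡ allVecsOf (true ∷ false ∷ []) n
allBoolVecs≡allVecsOf zero = refl
allBoolVecs≡allVecsOf (suc n) = cong (concatMap (λ v → (true ∷ v) ∷ (false ∷ v) ∷ [])) (allBoolVecs≡allVecsOf n)

enumerates-allBoolVecs : ∀ n → Enumerates (vec-boolEq boolEq n) (allBoolVecs n)
enumerates-allBoolVecs n rewrite allBoolVecs≡allVecsOf n = enumerates-allVecsOf boolEq _ enumerates-bool n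

∈-allBoolVecs : ∀ {n} (v : Vec Bool n) → v ∈ allBoolVecs n
∈-allBoolVecs {n} = enumerates-∈ (vec-boolEq boolEq n) {allBoolVecs n} (enumerates-allBoolVecs n)

length-allBoolVecs : ∀ n → length (allBoolVecs n) ≡ 2 ^ n
length-allBoolVecs zero = refl
length-allBoolVecs (suc n) = trans (length-doubled (allBoolVecs n)) (cong (2 *_) (length-allBoolVecs n))
  where
  length-doubled : ∀ (vs : List (Vec Bool n)) →
    length (concatMap (λ v → (true ∷ v) ∷ (false ∷ v) ∷ []) vs) ≡ 2 * length vs
  length-doubled [] = refl
  length-doubled (v ∷ vs) = trans (cong (_+_ 2) (length-doubled vs)) (sym (*-distribˡ-+ 2 1 (length vs)))

count-cartesian-proj₁ : ∀ {A B : Set} (p : A → Bool) xs (ys : List B) →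
  count (p ∘ proj₁) (cartesian xs ys) ≡ count p xs * length ys
count-cartesian-proj₁ p [] ys = refl
count-cartesian-proj₁ p (x ∷ xs) ys =
  begin
    count (p ∘ proj₁) (map (x ,_) ys ++ cartesian xs ys)
      ≡⟨ count-++ _ (map (x ,_) ys) (cartesian xs ys) ⟩
    count (p ∘ proj₁) (map (x ,_) ys) + count (p ∘ proj₁) (cartesian xs ys)
      ≡⟨ cong₂ _+_ (count-map _ (x ,_) ys) (count-cartesian-proj₁ p xs ys) ⟩
    count (λ _ → p x) ys + count p xs * length ys
      ≡⟨ row (p x) ⟩
    count p (x ∷ xs) * length ys ∎
  where
  count-true : ∀ (zs : List _) → count (λ _ → true) zs ≡ length zs
  count-true [] = refl
  count-true (_ ∷ zs) = cong suc (count-true zs)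
  row : ∀ b → count (λ _ → b) ys + count p xs * length ys ≡ (if b then suc (count p xs) else count p xs) * length ys
  row true = cong (_+ count p xs * length ys) (count-true ys)
  row false = cong (_+ count p xs * length ys) (count-false _ ys (λ _ → refl))

module _ {A B : Set} (EA : BoolEq A) (EB : BoolEq B) (xs : List A) (ys : List B)
  (onceA : Enumerates EA xs) (onceB : Enumerates EB ys) (p : A → Bool) (q : B → Bool) (f : A → B)
  (f-maps : ∀ a → p a ≡ true → q (f a) ≡ true)
  (f-injective : ∀ a a′ → p a ≡ true → p a′ ≡ true → f a ≡ f a′ → a ≡ a′)
  (f-surjective : ∀ b → q b ≡ true → Σ A λ a → p a ≡ true × f a ≡ b) where

  private
    graph : A → B → Bool
    graph a b = p a ∧ _==_ EB (f a) b

    row : ∀ a → [ p a ]ᵇ ≡ count (graph a) ys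
    row a with p a
    ... | true = sym (onceB (f a))
    ... | false = sym (count-false _ ys (λ _ → refl))

    column : ∀ b → count (λ a → graph a b) xs ≡ [ q b ]ᵇ
    column b with q b in qb
    ... | false = count-false _ xs λ {a} _ → ¬true⇒false λ e →
                    true≢false (subst (λ c → q c ≡ true) (==-sound EB _ _ (∧-elimʳ {p a} e)) (f-maps a (∧-elimˡ e))) qb
    ... | true with f-surjective b qb
    ... | a₀ , pa₀ , fa₀ = trans (count-cong _ _ xs (λ {a} _ → graph≡ a)) (onceA a₀)
      where
      graph≡ : ∀ a → graph a b ≡ _==_ EA a₀ a
      graph≡ a with _==_ EA a₀ a in e
      ... | true rewrite sym (==-sound EA a₀ a e) | pa₀ | fa₀ = ==-refl EB b
      ... | false = ¬true⇒false λ g → true≢false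
                      (subst (λ c → _==_ EA a₀ c ≡ true)
                        (f-injective a₀ a pa₀ (∧-elimˡ g) (trans fa₀ (sym (==-sound EB _ _ (∧-elimʳ {p a} g)))))
                        (==-refl EA a₀)) e

  count-bijection : count p xs ≡ count q ys
  count-bijection = begin
    count p xs                                          ≡⟨ count≡sum p xs ⟩
    sum (map (λ a → [ p a ]ᵇ) xs)                       ≡⟨ sum-map-cong _ _ xs (λ {a} _ → row a) ⟩
    sum (map (λ a → count (graph a) ys) xs)             ≡⟨ sum-count-swap graph xs ys ⟩
    sum (map (λ b → count (λ a → graph a b) xs) ys)     ≡⟨ sum-map-cong _ _ ys (λ {b} _ → column b) ⟩
    sum (map (λ b → [ q b ]ᵇ) ys)                       ≡⟨ count≡sum q ys ⟨
    count q ys                                          ∎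

-- Subsets of ⟨n⟩

memV-zero : ∀ {n} (v : Vec Bool n) → memV v 0 ≡ false
memV-zero [] = refl
memV-zero (_ ∷ _) = refl

memV⇒< : ∀ {n} (v : Vec Bool n) j → memV v j ≡ true → Σ ℕ λ i → j ≡ suc i × i < n
memV⇒< (_ ∷ _) 1 _ = 0 , refl , s≤s z≤n
memV⇒< (_ ∷ v) (suc (suc j)) e with memV⇒< v (suc j) e
... | i , refl , i<n = suc i , refl , s≤s i<n

memV-ext : ∀ {n} (v w : Vec Bool n) → (∀ i → i < n → memV v (suc i) ≡ memV w (suc i)) → v ≡ w
memV-ext [] [] _ = refl
memV-ext (b ∷ v) (c ∷ w) h = cong₂ _∷_ (h 0 (s≤s z≤n)) (memV-ext v w (λ i i<n → h (suc i) (s≤s i<n)))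

memV-map-not : ∀ {n} (v : Vec Bool n) i → i < n → memV (Vec.map not v) (suc i) ≡ not (memV v (suc i))
memV-map-not (_ ∷ _) zero _ = refl
memV-map-not (_ ∷ v) (suc i) (s≤s i<n) = memV-map-not v i i<n

map-not-involutive : ∀ {n} (v : Vec Bool n) → Vec.map not (Vec.map not v) ≡ v
map-not-involutive [] = refl
map-not-involutive (b ∷ v) = cong₂ _∷_ (not-involutive b) (map-not-involutive v)

memV-replicate : ∀ n i → i < n → memV (replicate n true) (suc i) ≡ true
memV-replicate (suc n) zero _ = refl
memV-replicate (suc n) (suc i) (s≤s i<n) = memV-replicate n i i<n

punctured : ∀ n → Fin n → Vec Bool n
punctured n i = replicate n true [ i ]≔ false

memV-punctured : ∀ n (j : Fin n) i → i < n → memV (punctured n j) (suc i) ≡ not (toℕ j ≡ᵇ i)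
memV-punctured (suc n) Fin.zero zero _ = refl
memV-punctured (suc n) Fin.zero (suc i) (s≤s i<n) = memV-replicate n i i<n
memV-punctured (suc n) (Fin.suc j) zero _ = refl
memV-punctured (suc n) (Fin.suc j) (suc i) (s≤s i<n) = memV-punctured n j i i<n

private
  pmPair : ℕ → List ℤ
  pmPair j = + suc j ∷ -[1+ j ] ∷ []

+suc∈pmElts : ∀ {n i} → i < n → + suc i ∈ pmElts n
+suc∈pmElts i<n = ∈-concatMap⁺ pmPair (lose (∈-upTo⁺ i<n) (here refl))

-[1+]∈pmElts : ∀ {n i} → i < n → -[1+ i ] ∈ pmElts n
-[1+]∈pmElts i<n = ∈-concatMap⁺ pmPair (lose (∈-upTo⁺ i<n) (there (here refl)))

∈pmElts⁻ : ∀ {n x} → x ∈ pmElts n → Σ ℕ λ i → i < n × (x ≡ + suc i ⊎ x ≡ -[1+ i ])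
∈pmElts⁻ {n} x∈ with find (∈-concatMap⁻ pmPair {xs = upTo n} x∈)
... | i , i∈ , here refl = i , ∈-upTo⁻ i∈ , inj₁ refl
... | i , i∈ , there (here refl) = i , ∈-upTo⁻ i∈ , inj₂ refl

memPM⇒∈pmElts : ∀ {n} (A : PMSet n) x → memPM A x ≡ true → x ∈ pmElts n
memPM⇒∈pmElts (p , _) (+ j) e with memV⇒< p j e
... | _ , refl , i<n = +suc∈pmElts i<n
memPM⇒∈pmElts (_ , q) -[1+ j ] e with memV⇒< q (suc j) e
... | _ , refl , i<n = -[1+]∈pmElts i<n

memPM-zero : ∀ {n} (A : PMSet n) → memPM A (+ 0) ≡ false
memPM-zero (p , _) = memV-zero p

memZ⇒∈ballElts : ∀ {n} (T : ZSet n) x → memZ T x ≡ true → x ∈ ballElts n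
memZ⇒∈ballElts _ (+ zero) _ = here refl
memZ⇒∈ballElts (_ , t) (+ suc j) e = there (memPM⇒∈pmElts t (+ suc j) e)
memZ⇒∈ballElts (_ , t) -[1+ j ] e = there (memPM⇒∈pmElts t -[1+ j ] e)

memPM-ext : ∀ {n} (A B : PMSet n) → (∀ x → memPM A x ≡ memPM B x) → A ≡ B
memPM-ext (p , q) (p′ , q′) h =
  cong₂ _,_ (memV-ext p p′ (λ i _ → h (+ suc i))) (memV-ext q q′ (λ i _ → h -[1+ i ]))

memZ-ext : ∀ {n} (A B : ZSet n) → (∀ x → memZ A x ≡ memZ B x) → A ≡ B
memZ-ext (b , t) (b′ , t′) h = cong₂ _,_ (h (+ 0)) (memPM-ext t t′ h′)
  where
  h′ : ∀ x → memPM t x ≡ memPM t′ x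
  h′ (+ zero) = trans (memPM-zero t) (sym (memPM-zero t′))
  h′ (+ suc j) = h (+ suc j)
  h′ -[1+ j ] = h -[1+ j ]

eqZ-sound : ∀ {n} (A B : ZSet n) → eqZ A B ≡ true → A ≡ B
eqZ-sound {n} A B e = memZ-ext A B agree
  where
  agree-on : ∀ {x} → x ∈ ballElts n → memZ A x ≡ memZ B x
  agree-on x∈ = ⇔ᵇ-sound (all-elim (λ x → memZ A x ⇔ᵇ memZ B x) e x∈)
  agree : ∀ x → memZ A x ≡ memZ B x
  agree x with memZ A x in a | memZ B x in b
  ... | false | false = refl
  ... | true | _ = trans (sym a) (trans (agree-on (memZ⇒∈ballElts A x a)) b)
  ... | false | true = trans (sym a) (trans (agree-on (memZ⇒∈ballElts B x b)) b)

eqZ-refl : ∀ {n} (A : ZSet n) → eqZ A A ≡ true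
eqZ-refl {n} A = all-intro _ (ballElts n) (λ {x} _ → ⇔ᵇ-refl (memZ A x))

memPM-conj : ∀ {n} (A : PMSet n) x → memPM (conjPM A) x ≡ memPM A (- x)
memPM-conj (p , q) (+ zero) = trans (memV-zero q) (sym (memV-zero p))
memPM-conj _ (+ suc _) = refl
memPM-conj _ -[1+ _ ] = refl

hasAbs : ∀ {n} → PMSet n → ℕ → Bool
hasAbs A j = memPM A (+ suc j) ∨ memPM A -[1+ j ]

private
  firstHit : (ℕ → Bool) → List ℕ → ℕ
  firstHit C = foldr (λ j r → if C j then suc j else r) 0

  firstHit-cong : (C D : ℕ → Bool) → (∀ j → C j ≡ D j) → ∀ xs → firstHit C xs ≡ firstHit D xs
  firstHit-cong C D h [] = refl
  firstHit-cong C D h (x ∷ xs) rewrite h x | firstHit-cong C D h xs = refl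

  firstHit-hit : (C : ℕ → Bool) → ∀ xs {i} → i ∈ xs → C i ≡ true →
    Σ ℕ λ j → firstHit C xs ≡ suc j × C j ≡ true
  firstHit-hit C (y ∷ ys) i∈ ci with C y in cy
  ... | true = y , refl , cy
  firstHit-hit C (y ∷ ys) (here refl) ci | false = ⊥-elim (true≢false ci cy)
  firstHit-hit C (y ∷ ys) (there i∈) ci | false = firstHit-hit C ys i∈ ci

minAbs-conj : ∀ {n} (A : PMSet n) → minAbs (conjPM A) ≡ minAbs A
minAbs-conj {n} (p , q) = firstHit-cong _ _ (λ j → ∨-comm (memV q (suc j)) (memV p (suc j))) (upTo n)

minAbs-attained : ∀ {n} (A : PMSet n) x → memPM A x ≡ true → Σ ℕ λ j → minAbs A ≡ suc j × hasAbs A j ≡ true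
minAbs-attained {n} A x e with ∈pmElts⁻ {n} (memPM⇒∈pmElts A x e)
... | i , i<n , inj₁ refl = firstHit-hit (hasAbs A) (upTo n) (∈-upTo⁺ i<n) (∨-introˡ e)
... | i , i<n , inj₂ refl = firstHit-hit (hasAbs A) (upTo n) (∈-upTo⁺ i<n) (∨-introʳ {memPM A (+ suc i)} e)

#V : ∀ {n} → Vec Bool n → ℕ
#V {n} v = count (λ i → memV v (suc i)) (upTo n)

cardZ-symmetric : ∀ {n} (v : Vec Bool n) → cardZ (true , (v , v)) ≡ suc (#V v + #V v)
cardZ-symmetric {n} v = cong suc (begin
  count (memZ (true , (v , v))) (pmElts n)
    ≡⟨ count-concatMap _ pmPair (upTo n) ⟩
  sum (map (λ i → count (memZ (true , (v , v))) (pmPair i)) (upTo n))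
    ≡⟨ sum-map-cong _ _ (upTo n) (λ {i} _ → both-signs i) ⟩
  sum (map (λ i → [ memV v (suc i) ]ᵇ + [ memV v (suc i) ]ᵇ) (upTo n))
    ≡⟨ sum-map-+ _ _ (upTo n) ⟩
  sum (map (λ i → [ memV v (suc i) ]ᵇ) (upTo n)) + sum (map (λ i → [ memV v (suc i) ]ᵇ) (upTo n))
    ≡⟨ cong₂ _+_ (count≡sum _ (upTo n)) (count≡sum _ (upTo n)) ⟨
  #V v + #V v ∎)
  where
  both-signs : ∀ i → count (memZ (true , (v , v))) (pmPair i) ≡ [ memV v (suc i) ]ᵇ + [ memV v (suc i) ]ᵇ
  both-signs i with memV v (suc i)
  ... | true = refl
  ... | false = refl

≡ᵇ-refl : ∀ i → (i ≡ᵇ i) ≡ true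
≡ᵇ-refl zero = refl
≡ᵇ-refl (suc i) = ≡ᵇ-refl i

≡ᵇ-sound : ∀ i j → (i ≡ᵇ j) ≡ true → i ≡ j
≡ᵇ-sound zero zero _ = refl
≡ᵇ-sound (suc i) (suc j) e = cong suc (≡ᵇ-sound i j e)

IsSingleton : ∀ {n} → Vec Bool n → ℕ → Set
IsSingleton {n} v i = ∀ j → j < n → memV v (suc j) ≡ (i ≡ᵇ j)

#V≡1⇒singleton : ∀ {n} (v : Vec Bool n) → #V v ≡ 1 → Σ ℕ λ i → i < n × IsSingleton v i
#V≡1⇒singleton {n} v one with count≡1⇒unique (λ i → memV v (suc i)) (upTo n) one
... | i , i∈ , vi , unique = i , ∈-upTo⁻ i∈ , at
  where
  at : IsSingleton v i
  at j j<n with memV v (suc j) in vj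
  ... | true rewrite unique (∈-upTo⁺ j<n) vj = sym (≡ᵇ-refl i)
  ... | false = sym (¬true⇒false λ i≡ᵇj →
                  true≢false vi (subst (λ m → memV v (suc m) ≡ false) (sym (≡ᵇ-sound i j i≡ᵇj)) vj))

count-≡ᵇ-upTo : ∀ n i → i < n → count (i ≡ᵇ_) (upTo n) ≡ 1
count-≡ᵇ-upTo (suc n) i i<n = trans (cong (count (i ≡ᵇ_)) upTo-suc) (count-shifted i i<n)
  where
  upTo-suc : upTo (suc n) ≡ 0 ∷ map suc (upTo n)
  upTo-suc = cong (0 ∷_) (sym (map-upTo suc n))
  count-shifted : ∀ i → i < suc n → count (i ≡ᵇ_) (0 ∷ map suc (upTo n)) ≡ 1
  count-shifted zero _ = cong suc (trans (count-map _ suc (upTo n)) (count-false _ (upTo n) (λ _ → refl)))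
  count-shifted (suc i) (s≤s i<n) = trans (count-map _ suc (upTo n)) (count-≡ᵇ-upTo n i i<n)

singleton⇒#V≡1 : ∀ {n} (v : Vec Bool n) i → i < n → IsSingleton v i → #V v ≡ 1
singleton⇒#V≡1 {n} v i i<n at =
  trans (count-cong _ _ (upTo n) (λ {j} j∈ → at j (∈-upTo⁻ j∈))) (count-≡ᵇ-upTo n i i<n)

pmSet-boolEq : ∀ n → BoolEq (PMSet n)
pmSet-boolEq n = ×-boolEq (vec-boolEq boolEq n) (vec-boolEq boolEq n)

enumerates-allPM : ∀ n → Enumerates (pmSet-boolEq n) (allPM n)
enumerates-allPM n = enumerates-cartesian (vec-boolEq boolEq n) (vec-boolEq boolEq n) (allBoolVecs n) (allBoolVecs n)
  (enumerates-allBoolVecs n) (enumerates-allBoolVecs n)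

zSet-boolEq : ∀ n → BoolEq (ZSet n)
zSet-boolEq n = record { _==_ = eqZ ; ==-sound = eqZ-sound ; ==-refl = eqZ-refl }

enumerates-allZ : ∀ n → Enumerates (zSet-boolEq n) (allZ n)
enumerates-allZ n = enumerates-resp-BoolEq (×-boolEq boolEq (pmSet-boolEq n)) (zSet-boolEq n) {allZ n}
  (enumerates-cartesian boolEq (pmSet-boolEq n) (true ∷ false ∷ []) (allPM n) enumerates-bool (enumerates-allPM n))

∈-allZ : ∀ {n} (T : ZSet n) → T ∈ allZ n
∈-allZ {n} = enumerates-∈ (zSet-boolEq n) (enumerates-allZ n)

∈-zip⁻ˡ : ∀ {A B : Set} {a : A} {b : B} as bs → (a , b) ∈ zip as bs → a ∈ as
∈-zip⁻ˡ (_ ∷ _) (_ ∷ _) (here refl) = here refl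
∈-zip⁻ˡ (_ ∷ as) (_ ∷ bs) (there ab∈) = there (∈-zip⁻ˡ as bs ab∈)

module _ {n : ℕ} where

  -- memFam with allZ n generalised to any index list, so that induction applies
  memFamOver : (xs : List (ZSet n)) → Vec Bool (length xs) → ZSet n → Bool
  memFamOver xs F T = any (λ (S , b) → b ∧ eqZ S T) (zip xs (toList F))

  tabulateOver : (xs : List (ZSet n)) → (ZSet n → Bool) → Vec Bool (length xs)
  tabulateOver [] g = []
  tabulateOver (x ∷ xs) g = g x ∷ tabulateOver xs g

  memFamOver-tabulate : ∀ xs g T → memFamOver xs (tabulateOver xs g) T ≡ any (λ S → g S ∧ eqZ S T) xs
  memFamOver-tabulate [] g T = refl
  memFamOver-tabulate (x ∷ xs) g T = cong (g x ∧ eqZ x T ∨_) (memFamOver-tabulate xs g T)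

  memFamOver-injective : ∀ xs → (∀ T → count (eqZ T) xs ≤ 1) →
    (F G : Vec Bool (length xs)) → (∀ T → memFamOver xs F T ≡ memFamOver xs G T) → F ≡ G
  memFamOver-injective [] _ [] [] _ = refl
  memFamOver-injective (x ∷ xs) atMostOnce (b ∷ F) (c ∷ G) h =
    cong₂ _∷_ head-agrees (memFamOver-injective xs atMostOnce′ F G tail-agrees)
    where
    x∉xs : ¬ (x ∈ xs)
    x∉xs x∈xs with atMostOnce x
    ... | le rewrite eqZ-refl x = count≡0⇒¬witness (eqZ x) xs (n<1⇒n≡0 le) x∈xs (eqZ-refl x)
    x∉ : ∀ (H : Vec Bool (length xs)) → memFamOver xs H x ≡ false
    x∉ H = any-false _ (zip xs (toList H)) λ {(S , d)} S∈ → ¬true⇒false λ e →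
      x∉xs (subst (_∈ xs) (eqZ-sound S x (∧-elimʳ {d} e)) (∈-zip⁻ˡ xs (toList H) S∈))
    head-agrees : b ≡ c
    head-agrees = cancel b c (eqZ-refl x) (x∉ F) (x∉ G) (h x)
      where
      cancel : ∀ b c {e u v} → e ≡ true → u ≡ false → v ≡ false → b ∧ e ∨ u ≡ c ∧ e ∨ v → b ≡ c
      cancel true true refl refl refl _ = refl
      cancel false false refl refl refl _ = refl
    atMostOnce′ : ∀ T → count (eqZ T) xs ≤ 1
    atMostOnce′ T with atMostOnce T
    ... | le with eqZ T x
    ... | true = ≤-trans (n≤1+n _) le
    ... | false = le
    tail-agrees : ∀ T → memFamOver xs F T ≡ memFamOver xs G T
    tail-agrees T with eqZ x T in e
    ... | true rewrite sym (eqZ-sound x T e) = trans (x∉ F) (sym (x∉ G))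
    ... | false = subst₂ _≡_ (drop-head b F) (drop-head c G) (h T)
      where
      drop-head : ∀ d (H : Vec Bool (length xs)) → memFamOver (x ∷ xs) (d ∷ H) T ≡ memFamOver xs H T
      drop-head d H rewrite e | ∧-zeroʳ d = refl

familyOf : ∀ {n} → List (ZSet n) → Family n
familyOf {n} Ts = tabulateOver (allZ n) (λ T → any (eqZ T) Ts)

memFam-familyOf : ∀ {n} (Ts : List (ZSet n)) T → memFam (familyOf Ts) T ≡ any (eqZ T) Ts
memFam-familyOf {n} Ts T = trans (memFamOver-tabulate (allZ n) (λ T → any (eqZ T) Ts) T) members
  where
  members : any (λ S → any (eqZ S) Ts ∧ eqZ S T) (allZ n) ≡ any (eqZ T) Ts
  members with any (eqZ T) Ts in e
  ... | true = any-intro _ (∈-allZ T) (∧-intro e (eqZ-refl T))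
  ... | false = any-false _ (allZ n) λ {S} _ → ¬true⇒false λ e′ →
      true≢false (subst (λ U → any (eqZ U) Ts ≡ true) (eqZ-sound S T (∧-elimʳ {any (eqZ S) Ts} e′)) (∧-elimˡ e′)) e

family-ext : ∀ {n} (F G : Family n) → (∀ T → memFam F T ≡ memFam G T) → F ≡ G
family-ext {n} = memFamOver-injective (allZ n) (λ T → ≤-reflexive (enumerates-allZ n T))

-- Interleavings and sorted lists

module _ {X : Set} where

  AllPairs-resp-↭ : {R : X → X → Set} → (∀ {a b} → R a b → R b a) →
    ∀ {xs ys} → xs ↭ ys → AllPairs R xs → AllPairs R ys
  AllPairs-resp-↭ sym-R (↭-refl) rs = rs
  AllPairs-resp-↭ sym-R (prep x p) (r ∷ rs) = All-resp-↭ p r ∷ AllPairs-resp-↭ sym-R p rs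
  AllPairs-resp-↭ sym-R (swap x y p) ((rxy ∷ rx) ∷ ry ∷ rs) =
    (sym-R rxy ∷ All-resp-↭ p ry) ∷ All-resp-↭ p rx ∷ AllPairs-resp-↭ sym-R p rs
  AllPairs-resp-↭ sym-R (↭-trans p q) rs = AllPairs-resp-↭ sym-R q (AllPairs-resp-↭ sym-R p rs)

  AllPairs-++⁻ : {R : X → X → Set} → ∀ xs {ys} → AllPairs R (xs ++ ys) →
    AllPairs R xs × AllPairs R ys × (∀ {a b} → a ∈ xs → b ∈ ys → R a b)
  AllPairs-++⁻ [] rs = [] , rs , λ ()
  AllPairs-++⁻ (x ∷ xs) (r ∷ rs) with AllPairs-++⁻ xs rs
  ... | rxs , rys , across =
    All.tabulate (All.lookup r ∘ ∈-++⁺ˡ) ∷ rxs , rys , λ where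
      (here refl) b∈ → All.lookup r (∈-++⁺ʳ xs b∈)
      (there a∈) b∈ → across a∈ b∈

  AllPairs-map-local : {R R′ : X → X → Set} → ∀ xs → (∀ {a b} → a ∈ xs → b ∈ xs → R a b → R′ a b) →
    AllPairs R xs → AllPairs R′ xs
  AllPairs-map-local [] f [] = []
  AllPairs-map-local (x ∷ xs) f (r ∷ rs) =
    All.tabulate (λ b∈ → f (here refl) (there b∈) (All.lookup r b∈))
    ∷ AllPairs-map-local xs (λ a∈ b∈ → f (there a∈) (there b∈)) rs

  module Interleaving (c : X → X) where

    interleave : List X → List X
    interleave = concatMap (λ a → a ∷ c a ∷ [])

    interleave-↭ : ∀ L → interleave L ↭ L ++ map c L
    interleave-↭ [] = ↭-refl
    interleave-↭ (a ∷ L) = prep a (↭-trans (prep (c a) (interleave-↭ L)) (↭-sym (shift (c a) L (map c L))))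

    interleave-resp-↭ : ∀ {L L′} → L ↭ L′ → interleave L ↭ interleave L′
    interleave-resp-↭ {L} {L′} p =
      ↭-trans (interleave-↭ L) (↭-trans (++⁺ p (map⁺ c p)) (↭-sym (interleave-↭ L′)))

    ∈-interleave⁻ : ∀ {b} L → b ∈ interleave L → Σ X λ a → a ∈ L × (b ≡ a ⊎ b ≡ c a)
    ∈-interleave⁻ (a ∷ L) (here refl) = a , here refl , inj₁ refl
    ∈-interleave⁻ (a ∷ L) (there (here refl)) = a , here refl , inj₂ refl
    ∈-interleave⁻ (a ∷ L) (there (there b∈)) with ∈-interleave⁻ L b∈
    ... | a′ , a′∈ , b≡ = a′ , there a′∈ , b≡

    ∈-interleave⁺ˡ : ∀ {a L} → a ∈ L → a ∈ interleave L
    ∈-interleave⁺ˡ (here refl) = here refl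
    ∈-interleave⁺ˡ (there a∈) = there (there (∈-interleave⁺ˡ a∈))

    ∈-interleave⁺ʳ : ∀ {a L} → a ∈ L → c a ∈ interleave L
    ∈-interleave⁺ʳ (here refl) = there (here refl)
    ∈-interleave⁺ʳ (there a∈) = there (there (∈-interleave⁺ʳ a∈))

    AllPairs-interleave⇒adjacent : {R : X → X → Set} → ∀ {L a} → AllPairs R (interleave L) → a ∈ L → R a (c a)
    AllPairs-interleave⇒adjacent ((r ∷ _) ∷ _) (here refl) = r
    AllPairs-interleave⇒adjacent (_ ∷ _ ∷ rs) (there a∈) = AllPairs-interleave⇒adjacent rs a∈

    interleave-reorient : (∀ a → c (c a) ≡ a) → {B : Set} (o : B → X → X) → (∀ b a → o b a ≡ a ⊎ o b a ≡ c a) →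
      ∀ {k} (bs : Vec B k) (v : Vec X k) → interleave (toList (Vec.zipWith o bs v)) ↭ interleave (toList v)
    interleave-reorient _ o _ [] [] = ↭-refl
    interleave-reorient c-involutive o o-cases (b ∷ bs) (a ∷ v) with o b a | o-cases b a
    ... | _ | inj₁ refl = prep a (prep (c a) (interleave-reorient c-involutive o o-cases bs v))
    ... | _ | inj₂ refl = subst (λ x → c a ∷ x ∷ _ ↭ a ∷ c a ∷ _) (sym (c-involutive a))
                            (swap (c a) a (interleave-reorient c-involutive o o-cases bs v))

  strictly-sorted-unique : (key : X → ℕ) → ∀ M M′ →
    AllPairs (λ a b → key a < key b) M → AllPairs (λ a b → key a < key b) M′ →
    (∀ {x} → x ∈ M → x ∈ M′) → (∀ {x} → x ∈ M′ → x ∈ M) → M ≡ M′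
  strictly-sorted-unique key [] [] _ _ _ _ = refl
  strictly-sorted-unique key [] (_ ∷ _) _ _ _ ⊇ with () ← ⊇ (here refl)
  strictly-sorted-unique key (_ ∷ _) [] _ _ ⊆ _ with () ← ⊆ (here refl)
  strictly-sorted-unique key (a ∷ M) (a′ ∷ M′) (a< ∷ s) (a′< ∷ s′) ⊆ ⊇ =
    cong₂ _∷_ a≡a′ (strictly-sorted-unique key M M′ s s′ ⊆-tail ⊇-tail)
    where
    a≡a′ : a ≡ a′
    a≡a′ with ⊆ (here refl) | ⊇ (here refl)
    ... | here e | _ = e
    ... | there _ | here e = sym e
    ... | there a∈M′ | there a′∈M = ⊥-elim (<-asym (All.lookup a′< a∈M′) (All.lookup a< a′∈M))
    ⊆-tail : ∀ {x} → x ∈ M → x ∈ M′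
    ⊆-tail {x} x∈ with ⊆ (there x∈)
    ... | here refl = ⊥-elim (<-irrefl refl (subst (λ y → key y < key x) a≡a′ (All.lookup a< x∈)))
    ... | there x∈′ = x∈′
    ⊇-tail : ∀ {x} → x ∈ M′ → x ∈ M
    ⊇-tail {x} x∈ with ⊇ (there x∈)
    ... | here refl = ⊥-elim (<-irrefl refl (subst (λ y → key y < key x) (sym a≡a′) (All.lookup a′< x∈)))
    ... | there x∈′ = x∈′

  sortedᵇ⇒AllPairs : (key : X → ℕ) → ∀ L → sortedᵇ (map key L) ≡ true → AllPairs (λ a b → key a ≤ key b) L
  sortedᵇ⇒AllPairs key [] _ = []
  sortedᵇ⇒AllPairs key (a ∷ []) _ = [] ∷ []
  sortedᵇ⇒AllPairs key (a ∷ b ∷ L) e with sortedᵇ⇒AllPairs key (b ∷ L) (∧-elimʳ {key a ≤ᵇ key b} e)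
  ... | b≤ ∷ rs = (a≤b ∷ All.map (≤-trans a≤b) b≤) ∷ b≤ ∷ rs
    where a≤b = ≤ᵇ⇒≤ (key a) (key b) (subst T (sym (∧-elimˡ e)) _)

  Linked⇒sortedᵇ : (key : X → ℕ) → ∀ {L} → Linked (λ a b → key a ≤ key b) L → sortedᵇ (map key L) ≡ true
  Linked⇒sortedᵇ key [] = refl
  Linked⇒sortedᵇ key [-] = refl
  Linked⇒sortedᵇ key (a≤b ∷ l) = ∧-intro (T⇒≡true (≤⇒≤ᵇ a≤b)) (Linked⇒sortedᵇ key l)
    where
    T⇒≡true : ∀ {b} → T b → b ≡ true
    T⇒≡true {true} _ = refl

-- Signed partitions as propositions

module _ {X : Set} (mem : X → ℤ → Bool) where

  DisjointBy : X → X → Set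
  DisjointBy a b = ∀ x → mem a x ≡ true → mem b x ≡ false

  DisjointBy-sym : ∀ {a b} → DisjointBy a b → DisjointBy b a
  DisjointBy-sym d x e = ¬true⇒false λ e′ → true≢false e (d x e′)

  module _ (U : List ℤ) where

    AllPairs⇒pairwiseDisjoint : ∀ Xs → AllPairs DisjointBy Xs → pairwiseDisjoint U mem Xs ≡ true
    AllPairs⇒pairwiseDisjoint [] _ = refl
    AllPairs⇒pairwiseDisjoint (a ∷ Xs) (d ∷ ds) =
      ∧-intro (all-intro _ Xs (λ b∈ → all-intro _ U (λ {x} _ → apart x (All.lookup d b∈))))
              (AllPairs⇒pairwiseDisjoint Xs ds)
      where
      apart : ∀ {b} x → DisjointBy a b → not (mem a x ∧ mem b x) ≡ true
      apart x d with mem a x in ax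
      ... | true rewrite d x ax = refl
      ... | false = refl

    pairwiseDisjoint⇒AllPairs : (∀ a x → mem a x ≡ true → x ∈ U) →
      ∀ Xs → pairwiseDisjoint U mem Xs ≡ true → AllPairs DisjointBy Xs
    pairwiseDisjoint⇒AllPairs _ [] _ = []
    pairwiseDisjoint⇒AllPairs mem⇒∈U (a ∷ Xs) e =
      All.tabulate (λ b∈ x ax → apart (all-elim _ (all-elim _ (proj₁ (∧-split e)) b∈) (mem⇒∈U a x ax)) ax)
      ∷ pairwiseDisjoint⇒AllPairs mem⇒∈U Xs (proj₂ (∧-split e))
      where
      apart : ∀ {u v} → not (u ∧ v) ≡ true → u ≡ true → v ≡ false
      apart e refl = not≡true⇒false e

Disjoint : ∀ {n} → PMSet n → PMSet n → Set
Disjoint = DisjointBy memPM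

DisjointZ : ∀ {n} → ZSet n → ZSet n → Set
DisjointZ = DisjointBy memZ

NonEmpty : ∀ {n} → PMSet n → Set
NonEmpty A = Σ ℤ λ x → memPM A x ≡ true

toZ : ∀ {n} → PMSet n → ZSet n
toZ A = (false , A)

memZ-toZ : ∀ {n} (A : PMSet n) x → memZ (toZ A) x ≡ memPM A x
memZ-toZ A (+ zero) = sym (memPM-zero A)
memZ-toZ A (+ suc j) = refl
memZ-toZ A -[1+ j ] = refl

record IsSSP (n : ℕ) (S : Vec Bool n) (L : List (PMSet n)) : Set where
  field
    nonempty : ∀ {A} → A ∈ L → NonEmpty A
    ⊆S : ∀ {A} → A ∈ L → ∀ x → memPM A x ≡ true → memV S ∣ x ∣ ≡ true
    disjoint : AllPairs Disjoint (L ++ map conjPM L)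
    covers : ∀ x → x ∈ pmElts n → memV S ∣ x ∣ ≡ true → Σ (PMSet n) λ B → B ∈ L ++ map conjPM L × memPM B x ≡ true
    sorted : sortedᵇ (map minAbs L) ≡ true

isSSP-sound : ∀ n k S (ss : Vec (PMSet n) k) → isSSP n k S ss ≡ true → IsSSP n S (toList ss)
isSSP-sound n k S ss e =
  let nonempty , e = ∧-split e
      ⊆S , e = ∧-split e
      disjoint , e = ∧-split e
      covers , sorted = ∧-split e
  in record
    { nonempty = λ A∈ → let (x , _ , Ax) = any-elim _ (pmElts n) (all-elim _ nonempty A∈) in x , Ax
    ; ⊆S = λ {A} A∈ x Ax → ⇒ᵇ-elim (all-elim _ (all-elim _ ⊆S A∈) (memPM⇒∈pmElts A x Ax)) Ax
    ; disjoint = pairwiseDisjoint⇒AllPairs memPM (pmElts n) memPM⇒∈pmElts _ disjoint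
    ; covers = λ x x∈ Sx → any-elim _ _ (⇒ᵇ-elim (all-elim _ covers x∈) Sx)
    ; sorted = sorted }

isSSP-complete : ∀ n k S (ss : Vec (PMSet n) k) → IsSSP n S (toList ss) → isSSP n k S ss ≡ true
isSSP-complete n k S ss ssp =
  ∧-intro (all-intro _ L (λ A∈ → let (x , Ax) = nonempty A∈ in any-intro _ (memPM⇒∈pmElts _ x Ax) Ax))
  (∧-intro (all-intro _ L (λ {A} A∈ → all-intro _ (pmElts n) (λ {x} _ → ⇒ᵇ-intro (memPM A x) (⊆S A∈ x))))
  (∧-intro (AllPairs⇒pairwiseDisjoint memPM (pmElts n) (L ++ map conjPM L) disjoint)
  (∧-intro (all-intro _ (pmElts n) (λ {x} x∈ → ⇒ᵇ-intro (memV S ∣ x ∣)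
              (λ Sx → let (B , B∈ , Bx) = covers x x∈ Sx in any-intro _ B∈ Bx)))
  sorted)))
  where
  open IsSSP ssp
  L = toList ss

record IsTypeDLabelling (n k : ℕ) (F : Family n) (t0 : ZSet n) (ps : Vec (ZSet n × ZSet n) k) : Set where
  Ts = labBlocks {n} {k} (t0 , ps)
  field
    nonempty : ∀ {T} → T ∈ Ts → Σ ℤ λ x → memZ T x ≡ true
    disjoint : AllPairs DisjointZ Ts
    covers : ∀ x → x ∈ ballElts n → Σ (ZSet n) λ T → T ∈ Ts × memZ T x ≡ true
    members : ∀ T → memFam F T ≡ any (eqZ T) Ts
    0∈t0 : memZ t0 (+ 0) ≡ true
    t0-symmetric : t0 ≡ conjZ t0
    conjugate-pairs : ∀ {pr} → pr ∈ toList ps → proj₂ pr ≡ conjZ (proj₁ pr)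
    card-t0≢3 : (cardZ t0 ≡ᵇ 3) ≡ false

isTypeDVia-sound : ∀ n k F t0 ps → isTypeDSignedPartitionVia n k F (t0 , ps) ≡ true → IsTypeDLabelling n k F t0 ps
isTypeDVia-sound n k F t0 ps e =
  let nonempty , e = ∧-split {all nonemptyZ Ts} e
      disjoint , e = ∧-split {pairwiseDisjoint (ballElts n) memZ Ts} e
      covers , e = ∧-split {all (λ x → any (λ T → memZ T x) Ts) (ballElts n)} e
      members , e = ∧-split {all (λ T → memFam F T ⇔ᵇ any (eqZ T) Ts) (allZ n)} e
      0∈t0 , e = ∧-split {memZ t0 (+ 0)} e
      t0-symmetric , e = ∧-split {eqZ t0 (conjZ t0)} e
      conjugate-pairs , card≢3 = ∧-split {all (λ (a , b) → eqZ b (conjZ a)) (toList ps)} e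
  in record
    { nonempty = λ {T} T∈ → let (x , _ , Tx) = any-elim (memZ T) (ballElts n) (all-elim nonemptyZ nonempty T∈) in x , Tx
    ; disjoint = pairwiseDisjoint⇒AllPairs memZ (ballElts n) memZ⇒∈ballElts Ts disjoint
    ; covers = λ x x∈ → any-elim (λ T → memZ T x) Ts (all-elim _ covers x∈)
    ; members = λ T → ⇔ᵇ-sound (all-elim (λ T → memFam F T ⇔ᵇ any (eqZ T) Ts) members (∈-allZ T))
    ; 0∈t0 = 0∈t0
    ; t0-symmetric = eqZ-sound _ _ t0-symmetric
    ; conjugate-pairs = λ {(a , b)} pr∈ → eqZ-sound _ _ (all-elim (λ (a , b) → eqZ b (conjZ a)) conjugate-pairs pr∈)
    ; card-t0≢3 = not≡true⇒false card≢3 }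
  where
  Ts = labBlocks {n} {k} (t0 , ps)

isTypeDVia-complete : ∀ n k F t0 ps → IsTypeDLabelling n k F t0 ps → isTypeDSignedPartitionVia n k F (t0 , ps) ≡ true
isTypeDVia-complete n k F t0 ps lab =
  ∧-intro (all-intro nonemptyZ Ts λ {T} T∈ →
            let (x , Tx) = nonempty T∈ in any-intro (memZ T) (memZ⇒∈ballElts _ x Tx) Tx)
  (∧-intro (AllPairs⇒pairwiseDisjoint memZ (ballElts n) Ts disjoint)
  (∧-intro (all-intro (λ x → any (λ T → memZ T x) Ts) (ballElts n) λ {x} x∈ →
            let (T , T∈ , Tx) = covers x x∈ in any-intro (λ T → memZ T x) T∈ Tx)
  (∧-intro (all-intro (λ T → memFam F T ⇔ᵇ any (eqZ T) Ts) (allZ n) λ {T} _ →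
            subst (λ b → (b ⇔ᵇ any (eqZ T) Ts) ≡ true) (sym (members T)) (⇔ᵇ-refl (any (eqZ T) Ts)))
  (∧-intro 0∈t0
  (∧-intro (subst (λ t → eqZ t0 t ≡ true) t0-symmetric (eqZ-refl t0))
  (∧-intro (all-intro (λ (a , b) → eqZ b (conjZ a)) (toList ps) λ {(a , b)} pr∈ →
            subst (λ t → eqZ t (conjZ a) ≡ true) (sym (conjugate-pairs pr∈)) (eqZ-refl (conjZ a)))
  (false⇒not≡true card-t0≢3)))))))
  where
  open IsTypeDLabelling lab

-- Orienting blocks

module _ {n : ℕ} where
  open Interleaving (conjPM {n}) public

sign : ∀ {n} → PMSet n → Bool
sign A = memPM A (+ minAbs A)

orient : ∀ {n} → Bool → PMSet n → PMSet n
orient b C = if b then C else conjPM C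

canonical : ∀ {n} → PMSet n → PMSet n
canonical A = orient (sign A) A

orient-sign-canonical : ∀ {n} (A : PMSet n) → A ≡ orient (sign A) (canonical A)
orient-sign-canonical A with sign A
... | true = refl
... | false = refl

canonical-cases : ∀ {n} (A : PMSet n) → canonical A ≡ A ⊎ canonical A ≡ conjPM A
canonical-cases A with sign A
... | true = inj₁ refl
... | false = inj₂ refl

orient-canonical-cases : ∀ {n} b (A : PMSet n) → orient b (canonical A) ≡ A ⊎ orient b (canonical A) ≡ conjPM A
orient-canonical-cases true A = canonical-cases A
orient-canonical-cases false A with canonical-cases A
... | inj₁ e = inj₂ (cong conjPM e)
... | inj₂ e = inj₁ (cong conjPM e)

minAbs-canonical : ∀ {n} (A : PMSet n) → minAbs (canonical A) ≡ minAbs A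
minAbs-canonical A with sign A
... | true = refl
... | false = minAbs-conj A

minAbs-orient-canonical : ∀ {n} b (A : PMSet n) → minAbs (orient b (canonical A)) ≡ minAbs A
minAbs-orient-canonical true A = minAbs-canonical A
minAbs-orient-canonical false A = trans (minAbs-conj (canonical A)) (minAbs-canonical A)

+minAbs∈canonical : ∀ {n} (A : PMSet n) → NonEmpty A →
  Σ ℕ λ j → minAbs A ≡ suc j × memPM (canonical A) (+ suc j) ≡ true
+minAbs∈canonical A (x , Ax) with minAbs-attained A x Ax
... | j , min≡ , ±j∈A with sign A in s
... | true = j , min≡ , subst (λ m → memPM A (+ m) ≡ true) min≡ s
... | false with ∨-elim {memPM A (+ suc j)} ±j∈A
...   | inj₁ +j∈A = ⊥-elim (true≢false (subst (λ m → memPM A (+ m) ≡ true) (sym min≡) +j∈A) s)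
...   | inj₂ -j∈A = j , min≡ , trans (memPM-conj A (+ suc j)) -j∈A

sign-canonical : ∀ {n} (A : PMSet n) → NonEmpty A → sign (canonical A) ≡ true
sign-canonical A ne with +minAbs∈canonical A ne
... | j , min≡ , +j∈ = subst (λ m → memPM (canonical A) (+ m) ≡ true) (sym (trans (minAbs-canonical A) min≡)) +j∈

sign-orient-canonical : ∀ {n} b (A : PMSet n) → NonEmpty A → Disjoint A (conjPM A) → sign (orient b (canonical A)) ≡ b
sign-orient-canonical true A ne _ = sign-canonical A ne
sign-orient-canonical false A ne A⟂Ā with +minAbs∈canonical A ne
... | j , min≡ , +j∈ =
  subst (λ m → memPM (conjPM (canonical A)) (+ m) ≡ false)
    (sym (trans (minAbs-conj (canonical A)) (trans (minAbs-canonical A) min≡))) (canonical-disjoint (+ suc j) +j∈)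
  where
  canonical-disjoint : Disjoint (canonical A) (conjPM (canonical A))
  canonical-disjoint with sign A
  ... | true = A⟂Ā
  ... | false = DisjointBy-sym memPM A⟂Ā

minAbs-distinct : ∀ {n} (A B : PMSet n) → NonEmpty A → NonEmpty B →
  Disjoint A B → Disjoint A (conjPM B) → Disjoint B (conjPM A) → minAbs A ≢ minAbs B
minAbs-distinct A B (x , Ax) (y , By) A⟂B A⟂B̄ B⟂Ā min≡
  with minAbs-attained A x Ax | minAbs-attained B y By
... | j , minA≡ , ±j∈A | j′ , minB≡ , ±j′∈B with suc-injective (trans (sym minA≡) (trans min≡ minB≡))
... | refl with ∨-elim {memPM A (+ suc j)} ±j∈A | ∨-elim {memPM B (+ suc j)} ±j′∈B
... | inj₁ a | inj₁ b = true≢false b (A⟂B (+ suc j) a)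
... | inj₁ a | inj₂ b = true≢false (trans (memPM-conj B (+ suc j)) b) (A⟂B̄ (+ suc j) a)
... | inj₂ a | inj₁ b = true≢false (trans (memPM-conj A (+ suc j)) a) (B⟂Ā (+ suc j) b)
... | inj₂ a | inj₂ b = true≢false b (A⟂B -[1+ j ] a)

module IsSSP-properties {n : ℕ} {S : Vec Bool n} {L : List (PMSet n)} (ssp : IsSSP n S L) where
  open IsSSP ssp

  private
    split = AllPairs-++⁻ L disjoint

  disjoint-conj : ∀ {A B} → A ∈ L → B ∈ L → Disjoint A (conjPM B)
  disjoint-conj A∈ B∈ = proj₂ (proj₂ split) A∈ (∈-map⁺ conjPM B∈)

  interleave-disjoint : AllPairs Disjoint (interleave L)
  interleave-disjoint = AllPairs-resp-↭ (DisjointBy-sym memPM) (↭-sym (interleave-↭ L)) disjoint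

  interleave-nonempty : ∀ {B} → B ∈ interleave L → NonEmpty B
  interleave-nonempty B∈ with ∈-interleave⁻ L B∈
  ... | A , A∈ , inj₁ refl = nonempty A∈
  ... | A , A∈ , inj₂ refl with nonempty A∈
  ... | x , Ax = - x , trans (memPM-conj A (- x)) (subst (λ y → memPM A y ≡ true) (sym (neg-involutive x)) Ax)

  minAbs-increasing : AllPairs (λ A B → minAbs A < minAbs B) L
  minAbs-increasing =
    AllPairs-map-local L
      (λ {A} {B} A∈ B∈ (A⟂B , A≤B) → ≤∧≢⇒< A≤B
        (minAbs-distinct A B (nonempty A∈) (nonempty B∈) A⟂B (disjoint-conj A∈ B∈) (disjoint-conj B∈ A∈)))
      (AllPairs.zip (proj₁ split , sortedᵇ⇒AllPairs minAbs L sorted))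

  canonical-minAbs-increasing : AllPairs (λ A B → minAbs A < minAbs B) (map canonical L)
  canonical-minAbs-increasing =
    AllPairs.map⁺ (AllPairs.map (λ {A} {B} → subst₂ _<_ (sym (minAbs-canonical A)) (sym (minAbs-canonical B)))
                                minAbs-increasing)

covered : ∀ {n} → List (PMSet n) → ℕ → Bool
covered L j = any (λ A → memPM A (+ j) ∨ memPM A (- (+ j))) L

covered-interleave : ∀ {n} (L : List (PMSet n)) {B} → B ∈ interleave L →
  ∀ x → memPM B x ≡ true → covered L ∣ x ∣ ≡ true
covered-interleave L {B} B∈ x Bx with ∈-interleave⁻ L B∈
covered-interleave L {B} B∈ (+ zero) Bx | _ = ⊥-elim (true≢false Bx (memPM-zero B))
covered-interleave L B∈ (+ suc j) Bx | A , A∈ , inj₁ refl = any-intro _ A∈ (∨-introˡ Bx)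
covered-interleave L B∈ (+ suc j) Bx | A , A∈ , inj₂ refl =
  any-intro _ A∈ (∨-introʳ {memPM A (+ suc j)} (trans (sym (memPM-conj A (+ suc j))) Bx))
covered-interleave L B∈ -[1+ j ] Bx | A , A∈ , inj₁ refl = any-intro _ A∈ (∨-introʳ {memPM A (+ suc j)} Bx)
covered-interleave L B∈ -[1+ j ] Bx | A , A∈ , inj₂ refl =
  any-intro _ A∈ (∨-introˡ (trans (sym (memPM-conj A -[1+ j ])) Bx))

covered≡support : ∀ {n S L} → IsSSP n S L → ∀ i → i < n → covered L (suc i) ≡ memV S (suc i)
covered≡support {n} {S} {L} ssp i i<n with covered L (suc i) in c | memV S (suc i) in s
... | true | true = refl
... | false | false = refl
... | true | false with any-elim _ L c
...   | A , A∈ , ±i∈A with ∨-elim {memPM A (+ suc i)} ±i∈A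
...     | inj₁ +i∈A = ⊥-elim (true≢false (IsSSP.⊆S ssp A∈ (+ suc i) +i∈A) s)
...     | inj₂ -i∈A = ⊥-elim (true≢false (IsSSP.⊆S ssp A∈ -[1+ i ] -i∈A) s)
covered≡support {n} {S} {L} ssp i i<n | false | true with IsSSP.covers ssp (+ suc i) (+suc∈pmElts i<n) s
... | B , B∈ , +i∈B with ∈-++⁻ L B∈
...   | inj₁ B∈L = ⊥-elim (true≢false (any-intro _ B∈L (∨-introˡ +i∈B)) c)
...   | inj₂ B∈L̄ with ∈-map⁻ conjPM B∈L̄
...     | A , A∈ , refl = ⊥-elim (true≢false (any-intro _ A∈ (∨-introʳ {memPM A (+ suc i)} +i∈B)) c)

support-unique : ∀ {n S S′ L} → IsSSP n S L → IsSSP n S′ L → S ≡ S′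
support-unique {n} ssp ssp′ =
  memV-ext _ _ (λ i i<n → trans (sym (covered≡support ssp i i<n)) (covered≡support ssp′ i i<n))

-- The bijection Φ

charVec : (n : ℕ) → (ℕ → Bool) → Vec Bool n
charVec zero g = []
charVec (suc n) g = g 1 ∷ charVec n (g ∘ suc)

memV-charVec : ∀ n g i → i < n → memV (charVec n g) (suc i) ≡ g (suc i)
memV-charVec (suc n) g zero _ = refl
memV-charVec (suc n) g (suc i) (s≤s i<n) = memV-charVec n (g ∘ suc) i i<n

zeroBlock : ∀ {n} → List (PMSet n) → ZSet n
zeroBlock {n} L = (true , (charVec n (not ∘ covered L) , charVec n (not ∘ covered L)))

blockPair : ∀ {n} → PMSet n → ZSet n × ZSet n
blockPair A = (toZ A , toZ (conjPM A))

labellingOf : ∀ {n k} → Vec (PMSet n) k → Labelling n k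
labellingOf ss = (zeroBlock (toList ss) , Vec.map blockPair ss)

partitionOf : ∀ {n k} → Vec (PMSet n) k → Family n
partitionOf {n} {k} ss = familyOf (labBlocks {n} {k} (labellingOf ss))

Φ : ∀ {n k} → Vec (PMSet n) k → Family n × Vec Bool k
Φ ss = (partitionOf ss , Vec.map sign ss)

labBlocks-labellingOf : ∀ {n k} (ss : Vec (PMSet n) k) →
  labBlocks {n} {k} (labellingOf ss) ≡ zeroBlock (toList ss) ∷ map toZ (interleave (toList ss))
labBlocks-labellingOf ss =
  cong (zeroBlock (toList ss) ∷_) (trans (cong (concatMap _) (toList-map blockPair ss)) (pairs (toList ss)))
  where
  pairs : ∀ L → concatMap (λ (a , b) → a ∷ b ∷ []) (map blockPair L) ≡ map toZ (interleave L)
  pairs [] = refl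
  pairs (A ∷ L) = cong (λ r → toZ A ∷ toZ (conjPM A) ∷ r) (pairs L)

zeroBlock≡complement : ∀ {n S L} → IsSSP n S L → zeroBlock L ≡ (true , (Vec.map not S , Vec.map not S))
zeroBlock≡complement {n} {S} {L} ssp = cong (λ v → true , (v , v)) (memV-ext _ _ λ i i<n → begin
  memV (charVec n (not ∘ covered L)) (suc i) ≡⟨ memV-charVec n _ i i<n ⟩
  not (covered L (suc i))                    ≡⟨ cong not (covered≡support ssp i i<n) ⟩
  not (memV S (suc i))                       ≡⟨ memV-map-not S i i<n ⟨
  memV (Vec.map not S) (suc i)               ∎)

complementBlock : ∀ {n} → Vec Bool n → ZSet n
complementBlock S = (true , (Vec.map not S , Vec.map not S))

cardZ-complementBlock≡3⇒punctured : ∀ {n} (S : Vec Bool n) → cardZ (complementBlock S) ≡ 3 →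
  Σ (Fin n) λ i → S ≡ punctured n i
cardZ-complementBlock≡3⇒punctured {n} S card≡3
  with #V≡1⇒singleton (Vec.map not S) (suc[c+c]≡3⇒c≡1 _ (trans (sym (cardZ-symmetric (Vec.map not S))) card≡3))
  where
  suc[c+c]≡3⇒c≡1 : ∀ c → suc (c + c) ≡ 3 → c ≡ 1
  suc[c+c]≡3⇒c≡1 1 _ = refl
  suc[c+c]≡3⇒c≡1 (suc (suc c)) e rewrite +-suc c (suc c) with () ← e
... | i , i<n , singleton = fromℕ< i<n , memV-ext S _ λ j j<n → begin
  memV S (suc j)                                         ≡⟨ not-involutive _ ⟨
  not (not (memV S (suc j)))                             ≡⟨ cong not (memV-map-not S j j<n) ⟨
  not (memV (Vec.map not S) (suc j))                     ≡⟨ cong not (singleton j j<n) ⟩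
  not (i ≡ᵇ j)                                           ≡⟨ cong (λ m → not (m ≡ᵇ j)) (toℕ-fromℕ< i<n) ⟨
  not (toℕ (fromℕ< i<n) ≡ᵇ j)                            ≡⟨ memV-punctured n (fromℕ< i<n) j j<n ⟨
  memV (punctured n (fromℕ< i<n)) (suc j)                ∎

cardZ-complementBlock-punctured : ∀ n i → cardZ (complementBlock (punctured n i)) ≡ 3
cardZ-complementBlock-punctured n i =
  trans (cardZ-symmetric (Vec.map not (punctured n i)))
        (cong (λ c → suc (c + c)) (singleton⇒#V≡1 (Vec.map not (punctured n i)) (toℕ i) (toℕ<n i) singleton))
  where
  singleton : IsSingleton (Vec.map not (punctured n i)) (toℕ i)
  singleton j j<n = begin
    memV (Vec.map not (punctured n i)) (suc j) ≡⟨ memV-map-not (punctured n i) j j<n ⟩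
    not (memV (punctured n i) (suc j))         ≡⟨ cong not (memV-punctured n i j j<n) ⟩
    not (not (toℕ i ≡ᵇ j))                     ≡⟨ not-involutive _ ⟩
    (toℕ i ≡ᵇ j)                               ∎

NotPunctured : ∀ {n} → Vec Bool n → Set
NotPunctured {n} S = ∀ i → S ≢ punctured n i

isDsub-sound : ∀ n k (ss : Vec (PMSet n) k) → isDsub n k ss ≡ true →
  Σ (Vec Bool n) λ S → IsSSP n S (toList ss) × NotPunctured S
isDsub-sound n k ss e with ∧-split {isPSSP n k ss} e
... | some , excluded with any-elim (λ S → isSSP n k S ss) (allBoolVecs n) some
... | S , _ , ssp = S , isSSP-sound n k S ss ssp , λ i S≡ →
  true≢false (any-intro _ (∈-allFin i) (subst (λ S → isSSP n k S ss ≡ true) S≡ ssp)) (not≡true⇒false excluded)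

isDsub-complete : ∀ n k (ss : Vec (PMSet n) k) S → IsSSP n S (toList ss) → NotPunctured S → isDsub n k ss ≡ true
isDsub-complete n k ss S ssp S≢ =
  ∧-intro (any-intro (λ S → isSSP n k S ss) (∈-allBoolVecs S) (isSSP-complete n k S ss ssp))
          (false⇒not≡true (any-false (λ i → isSSP n k (punctured n i) ss) (allFin n) λ {i} _ → ¬true⇒false λ sspᵢ →
             S≢ i (support-unique ssp (isSSP-sound n k _ ss sspᵢ))))

memZ-zeroBlock : ∀ {n} (L : List (PMSet n)) {x} → x ∈ pmElts n → memZ (zeroBlock L) x ≡ not (covered L ∣ x ∣)
memZ-zeroBlock {n} L x∈ with ∈pmElts⁻ {n} x∈
... | i , i<n , inj₁ refl = memV-charVec n (not ∘ covered L) i i<n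
... | i , i<n , inj₂ refl = memV-charVec n (not ∘ covered L) i i<n

module _ {n k : ℕ} (ss : Vec (PMSet n) k) {S : Vec Bool n} (ssp : IsSSP n S (toList ss)) (S≢ : NotPunctured S) where
  open IsSSP ssp
  open IsSSP-properties ssp

  private
    L = toList ss
    Ts≡ = labBlocks-labellingOf ss

    Ts-nonempty : ∀ {T} → T ∈ zeroBlock L ∷ map toZ (interleave L) → Σ ℤ λ x → memZ T x ≡ true
    Ts-nonempty (here refl) = + 0 , refl
    Ts-nonempty (there T∈) with ∈-map⁻ toZ T∈
    ... | B , B∈ , refl with interleave-nonempty B∈
    ... | x , Bx = x , trans (memZ-toZ B x) Bx

    zeroBlock-disjoint : ∀ {T} → T ∈ map toZ (interleave L) → DisjointZ (zeroBlock L) T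
    zeroBlock-disjoint T∈ x t0x with ∈-map⁻ toZ T∈
    ... | B , B∈ , refl = ¬true⇒false λ Tx → let Bx = trans (sym (memZ-toZ B x)) Tx in
      true≢false t0x (trans (memZ-zeroBlock L (memPM⇒∈pmElts B x Bx)) (cong not (covered-interleave L B∈ x Bx)))

    Ts-disjoint : AllPairs DisjointZ (zeroBlock L ∷ map toZ (interleave L))
    Ts-disjoint = All.tabulate zeroBlock-disjoint
      ∷ AllPairs.map⁺ (AllPairs.map (λ {A} {B} A⟂B x Ax → trans (memZ-toZ B x) (A⟂B x (trans (sym (memZ-toZ A x)) Ax)))
                                    interleave-disjoint)

    toZ∈Ts : ∀ {A} → A ∈ L → toZ A ∈ zeroBlock L ∷ map toZ (interleave L)
    toZ∈Ts A∈ = there (∈-map⁺ toZ (∈-interleave⁺ˡ A∈))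

    toZ-conj∈Ts : ∀ {A} → A ∈ L → toZ (conjPM A) ∈ zeroBlock L ∷ map toZ (interleave L)
    toZ-conj∈Ts A∈ = there (∈-map⁺ toZ (∈-interleave⁺ʳ A∈))

    Ts-covers : ∀ x → x ∈ ballElts n → Σ (ZSet n) λ T → T ∈ zeroBlock L ∷ map toZ (interleave L) × memZ T x ≡ true
    Ts-covers _ (here refl) = zeroBlock L , here refl , refl
    Ts-covers x (there x∈) with covered L ∣ x ∣ in c
    ... | false = zeroBlock L , here refl , trans (memZ-zeroBlock L x∈) (cong not c)
    ... | true with any-elim _ L c | ∈pmElts⁻ {n} x∈
    ... | A , A∈ , ±i∈A | i , _ , inj₁ refl with ∨-elim {memPM A (+ suc i)} ±i∈A
    ...   | inj₁ +i∈A = toZ A , toZ∈Ts A∈ , +i∈A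
    ...   | inj₂ -i∈A = toZ (conjPM A) , toZ-conj∈Ts A∈ , trans (memPM-conj A (+ suc i)) -i∈A
    Ts-covers _ (there x∈) | true | A , A∈ , ±i∈A | i , _ , inj₂ refl with ∨-elim {memPM A (+ suc i)} ±i∈A
    ...   | inj₁ +i∈A = toZ (conjPM A) , toZ-conj∈Ts A∈ , trans (memPM-conj A -[1+ i ]) +i∈A
    ...   | inj₂ -i∈A = toZ A , toZ∈Ts A∈ , -i∈A

    pairs-conjugate : ∀ {pr} → pr ∈ toList (Vec.map blockPair ss) → proj₂ pr ≡ conjZ (proj₁ pr)
    pairs-conjugate pr∈ with ∈-map⁻ blockPair (subst (_ ∈_) (toList-map blockPair ss) pr∈)
    ... | A , _ , refl = refl

    card≢3 : (cardZ (zeroBlock L) ≡ᵇ 3) ≡ false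
    card≢3 = ¬true⇒false λ card≡3 →
      let i , S≡ = cardZ-complementBlock≡3⇒punctured S
                     (trans (cong cardZ (sym (zeroBlock≡complement ssp))) (≡ᵇ-sound _ 3 card≡3))
      in S≢ i S≡

  labellingOf-typeD : IsTypeDLabelling n k (partitionOf ss) (zeroBlock L) (Vec.map blockPair ss)
  labellingOf-typeD = record
    { nonempty = λ {T} T∈ → Ts-nonempty (subst (T ∈_) Ts≡ T∈)
    ; disjoint = subst (AllPairs DisjointZ) (sym Ts≡) Ts-disjoint
    ; covers = λ x x∈ → let (T , T∈ , Tx) = Ts-covers x x∈ in T , subst (T ∈_) (sym Ts≡) T∈ , Tx
    ; members = memFam-familyOf (labBlocks {n} {k} (labellingOf ss))
    ; 0∈t0 = refl
    ; t0-symmetric = refl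
    ; conjugate-pairs = pairs-conjugate
    ; card-t0≢3 = card≢3 }

module _ {n k : ℕ} (ss : Vec (PMSet n) k) {S : Vec Bool n} (ssp : IsSSP n S (toList ss)) where
  open IsSSP ssp
  open IsSSP-properties ssp

  private
    L = toList ss
    Ts = labBlocks {n} {k} (labellingOf ss)

  canonical⇒block : ∀ {B} → B ∈ map canonical L → toZ B ∈ Ts × sign B ≡ true
  canonical⇒block B∈ with ∈-map⁻ canonical B∈
  ... | A , A∈ , refl = subst (toZ (canonical A) ∈_) (sym (labBlocks-labellingOf ss)) (there (∈-map⁺ toZ canonical∈)) ,
                        sign-canonical A (nonempty A∈)
    where
    canonical∈ : canonical A ∈ interleave L
    canonical∈ with canonical-cases A
    ... | inj₁ e = subst (_∈ interleave L) (sym e) (∈-interleave⁺ˡ A∈)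
    ... | inj₂ e = subst (_∈ interleave L) (sym e) (∈-interleave⁺ʳ A∈)

  block⇒canonical : ∀ {B} → toZ B ∈ Ts → sign B ≡ true → B ∈ map canonical L
  block⇒canonical {B} B∈ +min∈B with subst (toZ B ∈_) (labBlocks-labellingOf ss) B∈
  ... | there B∈′ with ∈-map⁻ toZ B∈′
  ... | B , B∈I , refl with ∈-interleave⁻ L B∈I
  ... | A , A∈ , inj₁ refl = subst (_∈ map canonical L) canonical≡ (∈-map⁺ canonical A∈)
    where
    canonical≡ : canonical A ≡ A
    canonical≡ rewrite +min∈B = refl
  ... | A , A∈ , inj₂ refl = subst (_∈ map canonical L) canonical≡ (∈-map⁺ canonical A∈)
    where
    sign≡ : sign A ≡ false
    sign≡ = ¬true⇒false λ +min∈A → true≢false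
      (subst (λ m → memPM (conjPM A) (+ m) ≡ true) (minAbs-conj A) +min∈B) (disjoint-conj A∈ A∈ (+ minAbs A) +min∈A)
    canonical≡ : canonical A ≡ conjPM A
    canonical≡ rewrite sign≡ = refl

canonical-sign-injective : ∀ {n k} (ss ss′ : Vec (PMSet n) k) →
  map canonical (toList ss) ≡ map canonical (toList ss′) → Vec.map sign ss ≡ Vec.map sign ss′ → ss ≡ ss′
canonical-sign-injective [] [] _ _ = refl
canonical-sign-injective (A ∷ ss) (A′ ∷ ss′) canonical≡ sign≡ = cong₂ _∷_
  (begin
    A                                    ≡⟨ orient-sign-canonical A ⟩
    orient (sign A) (canonical A)        ≡⟨ cong₂ orient (cong Vec.head sign≡) (∷-injectiveˡ canonical≡) ⟩
    orient (sign A′) (canonical A′)      ≡⟨ orient-sign-canonical A′ ⟨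
    A′                                   ∎)
  (canonical-sign-injective ss ss′ (∷-injectiveʳ canonical≡) (cong Vec.tail sign≡))

any-eqZ-⊆ : ∀ {n} (Xs Ys : List (ZSet n)) → (∀ T → any (eqZ T) Xs ≡ any (eqZ T) Ys) → ∀ {T} → T ∈ Xs → T ∈ Ys
any-eqZ-⊆ Xs Ys same {T} T∈ with any-elim (eqZ T) Ys (trans (sym (same T)) (any-intro (eqZ T) T∈ (eqZ-refl T)))
... | T′ , T′∈ , T≡T′ = subst (_∈ Ys) (sym (eqZ-sound T T′ T≡T′)) T′∈

Φ-injective : ∀ {n k} (ss ss′ : Vec (PMSet n) k) {S S′} → IsSSP n S (toList ss) → IsSSP n S′ (toList ss′) →
  Φ ss ≡ Φ ss′ → ss ≡ ss′
Φ-injective {n} {k} ss ss′ ssp ssp′ Φ≡ = canonical-sign-injective ss ss′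
  (strictly-sorted-unique minAbs _ _
    (IsSSP-properties.canonical-minAbs-increasing ssp) (IsSSP-properties.canonical-minAbs-increasing ssp′)
    (transfer ss ss′ ssp ssp′ same-blocks) (transfer ss′ ss ssp′ ssp (sym ∘ same-blocks)))
  (cong proj₂ Φ≡)
  where
  Ts : Vec (PMSet n) k → List (ZSet n)
  Ts ss = labBlocks {n} {k} (labellingOf ss)
  same-blocks : ∀ T → any (eqZ T) (Ts ss) ≡ any (eqZ T) (Ts ss′)
  same-blocks T = begin
    any (eqZ T) (Ts ss)        ≡⟨ memFam-familyOf (Ts ss) T ⟨
    memFam (partitionOf ss) T  ≡⟨ cong (λ F → memFam F T) (cong proj₁ Φ≡) ⟩
    memFam (partitionOf ss′) T ≡⟨ memFam-familyOf (Ts ss′) T ⟩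
    any (eqZ T) (Ts ss′)       ∎
  transfer : ∀ ss ss′ {S S′} → IsSSP n S (toList ss) → IsSSP n S′ (toList ss′) →
    (∀ T → any (eqZ T) (Ts ss) ≡ any (eqZ T) (Ts ss′)) →
    ∀ {B} → B ∈ map canonical (toList ss) → B ∈ map canonical (toList ss′)
  transfer ss ss′ ssp ssp′ same B∈ =
    let B∈Ts , +min∈B = canonical⇒block ss ssp B∈ in
    block⇒canonical ss′ ssp′ (any-eqZ-⊆ (Ts ss) (Ts ss′) same B∈Ts) +min∈B

-- a signed partition with zero block T₀ = {0} ∪ ±v and one representative A
-- of each pair {A, Ā} of non-zero blocks
record SignedPartitionBlocks (n : ℕ) (F : Family n) (v : Vec Bool n) (As : List (PMSet n)) : Set where
  t0 : ZSet n
  t0 = (true , (v , v))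
  field
    nonempty : ∀ {B} → B ∈ interleave As → NonEmpty B
    disjoint : AllPairs Disjoint (interleave As)
    apart-from-t0 : ∀ {B} → B ∈ interleave As → ∀ x → memPM B x ≡ true → memZ t0 x ≡ false
    covers : ∀ x → x ∈ pmElts n → memZ t0 x ≡ false → Σ (PMSet n) λ B → B ∈ interleave As × memPM B x ≡ true
    members : ∀ T → memFam F T ≡ any (eqZ T) (t0 ∷ map toZ (interleave As))
    card-t0≢3 : (cardZ t0 ≡ᵇ 3) ≡ false

module _ {n k : ℕ} {F : Family n} {v : Vec Bool n} {ps : Vec (ZSet n × ZSet n) k}
  (lab : IsTypeDLabelling n k F (true , (v , v)) ps) where
  open IsTypeDLabelling lab

  private
    t0 : ZSet n
    t0 = (true , (v , v))

    representative : ZSet n × ZSet n → PMSet n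
    representative ((_ , A) , _) = A

    As = map representative (toList ps)

    pair-shape : ∀ {pr} → pr ∈ toList ps → pr ≡ blockPair (representative pr)
    pair-shape {(b , A) , _} pr∈ with All.lookup (AllPairs.head disjoint) (∈-concatMap⁺ _ (lose pr∈ (here refl))) (+ 0) 0∈t0
                                    | conjugate-pairs pr∈
    ... | refl | refl = refl

    blocks≡ : Ts ≡ t0 ∷ map toZ (interleave As)
    blocks≡ = cong (t0 ∷_) (pairs (toList ps) pair-shape)
      where
      pairs : ∀ prs → (∀ {pr} → pr ∈ prs → pr ≡ blockPair (representative pr)) →
        concatMap (λ (a , b) → a ∷ b ∷ []) prs ≡ map toZ (interleave (map representative prs))
      pairs [] _ = refl
      pairs (pr ∷ prs) shape with shape (here refl)
      ... | refl = cong (λ r → toZ (representative pr) ∷ toZ (conjPM (representative pr)) ∷ r) (pairs prs (shape ∘ there))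

    disjoint′ : AllPairs DisjointZ (t0 ∷ map toZ (interleave As))
    disjoint′ = subst (AllPairs DisjointZ) blocks≡ disjoint

  typeDLabelling⇒blocks : SignedPartitionBlocks n F v As
  typeDLabelling⇒blocks = record
    { nonempty = λ {B} B∈ → let (x , Bx) = nonempty (subst (toZ B ∈_) (sym blocks≡) (there (∈-map⁺ toZ B∈)))
                            in x , trans (sym (memZ-toZ B x)) Bx
    ; disjoint = AllPairs.map (λ {A} {B} A⟂B x Ax → trans (sym (memZ-toZ B x)) (A⟂B x (trans (memZ-toZ A x) Ax)))
                   (AllPairs.map⁻ (AllPairs.tail disjoint′))
    ; apart-from-t0 = λ {B} B∈ x Bx → ¬true⇒false λ t0x →
        true≢false (trans (memZ-toZ B x) Bx) (All.lookup (AllPairs.head disjoint′) (∈-map⁺ toZ B∈) x t0x)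
    ; covers = covers′
    ; members = λ T → trans (members T) (cong (any (eqZ T)) blocks≡)
    ; card-t0≢3 = card-t0≢3 }
    where
    covers′ : ∀ x → x ∈ pmElts n → memZ t0 x ≡ false → Σ (PMSet n) λ B → B ∈ interleave As × memPM B x ≡ true
    covers′ x x∈ t0x with covers x (there x∈)
    ... | T , T∈ , Tx with subst (T ∈_) blocks≡ T∈
    ...   | here refl = ⊥-elim (true≢false Tx t0x)
    ...   | there T∈′ with ∈-map⁻ toZ T∈′
    ...     | B , B∈ , refl = B , B∈ , trans (sym (memZ-toZ B x)) Tx

  length-representatives : length As ≡ k
  length-representatives = trans (length-map representative (toList ps)) (length-toList ps)

module SortByMinAbs (n : ℕ) = Data.List.Sort (On.decTotalOrder ≤-decTotalOrder (minAbs {n}))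

module _ {n k : ℕ} {F : Family n} {v : Vec Bool n} {As : List (PMSet n)}
  (sp : SignedPartitionBlocks n F v As) (length≡ : length As ≡ k) (σ : Vec Bool k) where
  open SignedPartitionBlocks sp
  open SortByMinAbs n using (sort; sort-↭; sort-↗)

  private
    sorted-length≡ : length (sort As) ≡ k
    sorted-length≡ = trans (↭-length (sort-↭ As)) length≡

    representatives : Vec (PMSet n) k
    representatives = Vec.cast sorted-length≡ (Vec.fromList (sort As))

    toList-representatives : toList representatives ≡ sort As
    toList-representatives = trans (toList-cast sorted-length≡ (Vec.fromList (sort As))) (toList∘fromList (sort As))

    ∈-representatives : ∀ {A} → A ∈ toList representatives → A ∈ As
    ∈-representatives {A} A∈ = ∈-resp-↭ (sort-↭ As) (subst (A ∈_) toList-representatives A∈)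

    orientBy : Bool → PMSet n → PMSet n
    orientBy b A = orient b (canonical A)

  preimage : Vec (PMSet n) k
  preimage = Vec.zipWith orientBy σ representatives

  private
    L = toList preimage
    S = Vec.map not v

    interleave-preimage : interleave L ↭ interleave As
    interleave-preimage =
      ↭-trans (interleave-reorient (λ _ → refl) orientBy orient-canonical-cases σ representatives)
              (subst (λ w → interleave w ↭ interleave As) (sym toList-representatives) (interleave-resp-↭ (sort-↭ As)))

    ∈interleaveAs : ∀ {B} → B ∈ L ++ map conjPM L → B ∈ interleave As
    ∈interleaveAs B∈ = ∈-resp-↭ interleave-preimage (∈-resp-↭ (↭-sym (interleave-↭ L)) B∈)

    ∈L++L̄ : ∀ {B} → B ∈ interleave As → B ∈ L ++ map conjPM L
    ∈L++L̄ B∈ = ∈-resp-↭ (interleave-↭ L) (∈-resp-↭ (↭-sym interleave-preimage) B∈)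

    memV-S : ∀ {x} → x ∈ pmElts n → memV S ∣ x ∣ ≡ not (memZ t0 x)
    memV-S x∈ with ∈pmElts⁻ {n} x∈
    ... | i , i<n , inj₁ refl = memV-map-not v i i<n
    ... | i , i<n , inj₂ refl = memV-map-not v i i<n

    minAbs-preimage : ∀ {k′} (bs : Vec Bool k′) (W : Vec (PMSet n) k′) →
      map minAbs (toList (Vec.zipWith orientBy bs W)) ≡ map minAbs (toList W)
    minAbs-preimage [] [] = refl
    minAbs-preimage (b ∷ bs) (A ∷ W) = cong₂ _∷_ (minAbs-orient-canonical b A) (minAbs-preimage bs W)

  preimage-IsSSP : IsSSP n S L
  preimage-IsSSP = record
    { nonempty = λ A∈ → nonempty (∈interleaveAs (∈-++⁺ˡ A∈))
    ; ⊆S = λ {A} A∈ x Ax → let x∈ = memPM⇒∈pmElts A x Ax in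
        trans (memV-S x∈) (cong not (apart-from-t0 (∈interleaveAs (∈-++⁺ˡ A∈)) x Ax))
    ; disjoint = AllPairs-resp-↭ (DisjointBy-sym memPM) (interleave-↭ L)
                   (AllPairs-resp-↭ (DisjointBy-sym memPM) (↭-sym interleave-preimage) disjoint)
    ; covers = λ x x∈ Sx → let (B , B∈ , Bx) = covers x x∈ (not-injective (trans (sym (memV-S x∈)) Sx)) in
        B , ∈L++L̄ B∈ , Bx
    ; sorted = subst (λ ms → sortedᵇ ms ≡ true)
                 (sym (trans (minAbs-preimage σ representatives) (cong (map minAbs) toList-representatives)))
                 (Linked⇒sortedᵇ minAbs (sort-↗ As)) }

  private
    zeroBlock≡t0 : zeroBlock L ≡ t0
    zeroBlock≡t0 = trans (zeroBlock≡complement preimage-IsSSP) (cong (λ u → true , (u , u)) (map-not-involutive v))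

  preimage-NotPunctured : NotPunctured S
  preimage-NotPunctured i S≡ = true≢false (subst (λ c → (c ≡ᵇ 3) ≡ true) (sym card≡3) (≡ᵇ-refl 3)) card-t0≢3
    where
    card≡3 : cardZ t0 ≡ 3
    card≡3 = begin
      cardZ t0                                  ≡⟨ cong cardZ zeroBlock≡t0 ⟨
      cardZ (zeroBlock L)                       ≡⟨ cong cardZ (zeroBlock≡complement preimage-IsSSP) ⟩
      cardZ (complementBlock S)                 ≡⟨ cong (cardZ ∘ complementBlock) S≡ ⟩
      cardZ (complementBlock (punctured n i))   ≡⟨ cardZ-complementBlock-punctured n i ⟩
      3                                         ∎

  preimage-partition : partitionOf preimage ≡ F
  preimage-partition = family-ext _ F λ T → begin
    memFam (partitionOf preimage) T                          ≡⟨ memFam-familyOf (labBlocks {n} {k} (labellingOf preimage)) T ⟩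
    any (eqZ T) (labBlocks {n} {k} (labellingOf preimage))   ≡⟨ cong (any (eqZ T)) (labBlocks-labellingOf preimage) ⟩
    any (eqZ T) (zeroBlock L ∷ map toZ (interleave L))       ≡⟨ cong (λ t → any (eqZ T) (t ∷ map toZ (interleave L))) zeroBlock≡t0 ⟩
    any (eqZ T) (t0 ∷ map toZ (interleave L))                ≡⟨ any-resp-↭ (eqZ T) (prep t0 (map⁺ toZ interleave-preimage)) ⟩
    any (eqZ T) (t0 ∷ map toZ (interleave As))               ≡⟨ members T ⟨
    memFam F T                                               ∎

  preimage-sign : Vec.map sign preimage ≡ σ
  preimage-sign = signs σ representatives ∈-representatives
    where
    signs : ∀ {k′} (bs : Vec Bool k′) (W : Vec (PMSet n) k′) → (∀ {A} → A ∈ toList W → A ∈ As) →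
      Vec.map sign (Vec.zipWith orientBy bs W) ≡ bs
    signs [] [] _ = refl
    signs (b ∷ bs) (A ∷ W) ⊆As = cong₂ _∷_
      (sign-orient-canonical b A (nonempty (∈-interleave⁺ˡ A∈)) (AllPairs-interleave⇒adjacent disjoint A∈))
      (signs bs W (⊆As ∘ there))
      where A∈ = ⊆As (here refl)

Φ-surjective : ∀ n k (F : Family n) (σ : Vec Bool k) → isTypeDSignedPartition n k F ≡ true →
  Σ (Vec (PMSet n) k) λ ss → isDsub n k ss ≡ true × Φ ss ≡ (F , σ)
Φ-surjective n k F σ typeD
  with any-elim (isTypeDSignedPartitionVia n k F) (cartesian (allZ n) (allVecsOf (cartesian (allZ n) (allZ n)) k)) typeD
... | (t0 , ps) , _ , via with isTypeDVia-sound n k F t0 ps via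
... | lab with IsTypeDLabelling.0∈t0 lab | cong (proj₁ ∘ proj₂) (IsTypeDLabelling.t0-symmetric lab)
... | refl | refl = preimage sp len σ ,
                   isDsub-complete n k _ _ (preimage-IsSSP sp len σ) (preimage-NotPunctured sp len σ) ,
                   cong₂ _,_ (preimage-partition sp len σ) (preimage-sign sp len σ)
  where
  sp = typeDLabelling⇒blocks lab
  len = length-representatives lab

∈-labellings : ∀ {n k} (lab : Labelling n k) → lab ∈ cartesian (allZ n) (allVecsOf (cartesian (allZ n) (allZ n)) k)
∈-labellings {n} {k} = enumerates-∈ (×-boolEq ZE (vec-boolEq (×-boolEq ZE ZE) k))
  (enumerates-cartesian ZE (vec-boolEq (×-boolEq ZE ZE) k) (allZ n) _ (enumerates-allZ n)
  (enumerates-allVecsOf _ _ (enumerates-cartesian ZE ZE (allZ n) (allZ n) (enumerates-allZ n) (enumerates-allZ n)) k))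
  where ZE = zSet-boolEq n

Φ-typeD : ∀ n k (ss : Vec (PMSet n) k) → isDsub n k ss ≡ true → isTypeDSignedPartition n k (partitionOf ss) ≡ true
Φ-typeD n k ss dsub with isDsub-sound n k ss dsub
... | S , ssp , S≢ = any-intro (isTypeDSignedPartitionVia n k (partitionOf ss)) (∈-labellings (labellingOf ss))
  (isTypeDVia-complete n k _ _ _ (labellingOf-typeD ss ssp S≢))

#Dsub≡#typeD×signs : ∀ n k →
  #Dsub n k ≡ count (isTypeDSignedPartition n k ∘ proj₁) (cartesian (allBoolVecs (length (allZ n))) (allBoolVecs k))
#Dsub≡#typeD×signs n k =
  count-bijection (vec-boolEq (pmSet-boolEq n) k) (×-boolEq (vec-boolEq boolEq m) (vec-boolEq boolEq k))
    (allVecsOf (allPM n) k) (cartesian (allBoolVecs m) (allBoolVecs k))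
    (enumerates-allVecsOf _ (allPM n) (enumerates-allPM n) k)
    (enumerates-cartesian (vec-boolEq boolEq m) (vec-boolEq boolEq k) (allBoolVecs m) (allBoolVecs k)
      (enumerates-allBoolVecs m) (enumerates-allBoolVecs k))
    (isDsub n k) (isTypeDSignedPartition n k ∘ proj₁) Φ
    (Φ-typeD n k)
    (λ ss ss′ dsub dsub′ → Φ-injective ss ss′ (proj₁ (proj₂ (isDsub-sound n k ss dsub)))
                                                (proj₁ (proj₂ (isDsub-sound n k ss′ dsub′))))
    (λ (F , σ) typeD → Φ-surjective n k F σ typeD)
  where
  m = length (allZ n)

lemma3p2 : (n k : ℕ) → k ≤ n → 2 ^ k * S-D n k ≡ #Dsub n k
lemma3p2 n k _ = begin
  2 ^ k * S-D n k                   ≡⟨ *-comm (2 ^ k) (S-D n k) ⟩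
  S-D n k * 2 ^ k                   ≡⟨ cong (S-D n k *_) (length-allBoolVecs k) ⟨
  S-D n k * length (allBoolVecs k)  ≡⟨ count-cartesian-proj₁ (isTypeDSignedPartition n k) families (allBoolVecs k) ⟨
  count (isTypeDSignedPartition n k ∘ proj₁) (cartesian families (allBoolVecs k))
                                    ≡⟨ #Dsub≡#typeD×signs n k ⟨
  #Dsub n k                         ∎
  where
  families = allBoolVecs (length (allZ n))
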